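{- Let $\pi$ be an almost noncrossing set partition of $[n]$. For each index $i$ at which $\pi$ crosses, the element $\sigma_i(\pi)$ is a $\mathbb{Q}$-linear combination of noncrossing set partitions of $[n]$, and $\sigma_i(\pi)$ does not depend on the choice of such $i$ (so $\sigma(\pi):=\sigma_i(\pi)$ is well defined). Moreover, every set partition appearing in $\sigma(\pi)$ has the same number of blocks and the same number of singleton blocks as $\pi$.
   Context: $[n]=\{1,\dots,n\}$, $\mathfrak{S}_n$ is the symmetric group on $[n]$, $s_i=(i,i+1)$. For $w\in\mathfrak{S}_n$ and a set partition $\pi$ of $[n]$, $w(\pi)$ is the set partition in which $w(a),w(b)$ share a block iff $a,b$ share a block of $\pi$. $B_i(\pi)$ is the block of $\pi$ containing $i$. A set partition is noncrossing if whenever $a<b<c<d$ with $a,c$ in the same block and $b,d$ in the same block, all four lie in the same block. A set partition $\pi$ is almost noncrossing if it is not noncrossing but $s_i(\pi)$ is noncrossing for some $1\le i\le n-1$; we then say $\pi$ crosses at $i$. For $\pi$ almost noncrossing crossing at $i$, write $B_i(\pi)=\{i,a_1,\dots,a_k\}$ and $B_{i+1}(\pi)=\{i+1,b_1,\dots,b_\ell\}$ (so $k,\ell\ge1$). Let $\pi_1=s_i(\pi)$, and let $\pi_2,\pi_3,\pi_4$ be obtained from $\pi$ by replacing the two blocks $B_i(\pi),B_{i+1}(\pi)$ with: $\{i,i+1\}$ and $\{a_1,\dots,a_k,b_1,\dots,b_\ell\}$ (for $\pi_2$); $\{i,i+1,a_1,\dots,a_k\}$ and $\{b_1,\dots,b_\ell\}$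 (for $\pi_3$); $\{i,i+1,b_1,\dots,b_\ell\}$ and $\{a_1,\dots,a_k\}$ (for $\pi_4$). Define the formal $\mathbb{Q}$-linear combination $\sigma_i(\pi)=\pi_1+\pi_2-\pi_3-\pi_4$ if $k,\ell\ge2$; if $\ell=1$ delete the $\pi_3$ term; if $k=1$ delete the $\pi_4$ term (both are deleted if $k=\ell=1$). -}

module Defs where

open import Data.Nat as ℕ using (ℕ; zero; suc; _<_)
open import Data.Fin as Fin using (Fin; toℕ; fromℕ<)
open import Data.Fin.Properties using (all?)
open import Data.Bool using (Bool; true; false; if_then_else_; _∧_; _∨_; not)
open import Data.List using (List; []; _∷_; _++_; filter; length; sum; map; allFin)
open import Data.Product using (_×_; _,_; ∃; ∃-syntax; proj₁; proj₂)
open import Data.Rational using (ℚ; 1ℚ; 0ℚ; -_) renaming (_+_ to _+ℚ_)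
open import Relation.Nullary using (¬_; Dec; yes; no; does)
open import Relation.Nullary.Decidable using (⌊_⌋)
open import Relation.Binary.PropositionalEquality using (_≡_; _≢_)

-- Elements of [n] are represented 0-based as Fin n (paper's element m is Fin index m-1).
-- A set partition of [n] is represented by a block-labelling  π : Fin n → ℕ ;
-- a and b lie in the same block iff  π a ≡ π b.  Two labellings represent the
-- same set partition iff they have the same kernel (see _≈ₚ_ / sameKernel).
SetPartition : ℕ → Set
SetPartition n = Fin n → ℕ

SameBlock : ∀ {n} → SetPartition n → Fin n → Fin n → Set
SameBlock π a b = π a ≡ π b

_≡ᵇ_ : ℕ → ℕ → Bool
m ≡ᵇ k = ⌊ m ℕ.≟ k ⌋

sameKernel : ∀ {n} → SetPartition n → SetPartition n → Bool
sameKernel {n} π ρ = ⌊ all? (λ a → all? (λ b → Data.Bool._≟_ (π a ≡ᵇ π b) (ρ a ≡ᵇ ρ b))) ⌋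
  where import Data.Bool

NonCrossing : ∀ {n} → SetPartition n → Set
NonCrossing {n} π = (a b c d : Fin n) → a Fin.< b → b Fin.< c → c Fin.< d →
  SameBlock π a c → SameBlock π b d → SameBlock π a b

-- the simple transposition s_{j+1} = (j+1, j+2) of the paper, acting on 0-based Fin n:
-- swaps the elements with 0-based indices j and j+1  (requires j+1 < n).
s : ∀ {n} (j : ℕ) → suc j < n → Fin n → Fin n
s {n} j p x with toℕ x ℕ.≟ j | toℕ x ℕ.≟ suc j
... | yes _ | _     = fromℕ< p
... | no _  | yes _ = fromℕ< {j} (ℕ.<-trans (ℕ.n<1+n j) p)
  where import Data.Nat.Properties as ℕ
... | no _  | no _  = x

-- w(π) for w = s_j : since s_j is an involution, w(π)(x) = π(w⁻¹ x) = π(s_j x)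
act : ∀ {n} (j : ℕ) → suc j < n → SetPartition n → SetPartition n
act j p π x = π (s j p x)

-- π crosses at (0-based) j  (paper's index i = j+1): π is not noncrossing and s_i(π) is
CrossesAt : ∀ {n} → SetPartition n → (j : ℕ) → suc j < n → Set
CrossesAt π j p = ¬ NonCrossing π × NonCrossing (act j p π)

AlmostNoncrossing : ∀ {n} → SetPartition n → Set
AlmostNoncrossing {n} π = ¬ NonCrossing π × ∃[ j ] Σ' j
  where
  open import Data.Product using (Σ)
  Σ' : ℕ → Set
  Σ' j = Σ (suc j < n) (λ p → NonCrossing (act j p π))

blockSize : ∀ {n} → SetPartition n → ℕ → ℕ
blockSize {n} π α = length (filter (λ x → π x ℕ.≟ α) (allFin n))

numBlocks : ∀ {n} → SetPartition n → ℕ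
numBlocks {n} π = length (filter (λ x → all? (λ y → y Fin.<? x →? (¬? (π y ℕ.≟ π x)))) (allFin n))
  where
  open import Relation.Nullary.Decidable using (¬?; _→-dec_)
  _→?_ = _→-dec_
  infixr 2 _→?_

numSingletons : ∀ {n} → SetPartition n → ℕ
numSingletons {n} π = length (filter (λ x → blockSize π (π x) ℕ.≟ 1) (allFin n))

LinComb : ℕ → Set
LinComb n = List (ℚ × SetPartition n)

coeff : ∀ {n} → LinComb n → SetPartition n → ℚ
coeff [] ρ = 0ℚ
coeff ((c , p) ∷ L) ρ = (if sameKernel p ρ then c else 0ℚ) +ℚ coeff L ρ

-- σ_i(π) for i = j+1 (0-based elements u = j, v = j+1).
-- New labellings use 0 and 1 for the two modified blocks and shift all other labels by 2.
module _ {n} (π : SetPartition n) (j : ℕ) (p : suc j < n) where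
  private
    u v : Fin n
    u = s j p (fromℕ< p)      -- element j (0-based), i.e. paper's i
    v = fromℕ< p              -- element j+1 (0-based), i.e. paper's i+1
    α β : ℕ
    α = π u
    β = π v
    isUV : Fin n → Bool
    isUV x = ⌊ x Fin.≟ u ⌋ ∨ ⌊ x Fin.≟ v ⌋
    k ℓ : ℕ
    k = blockSize π α ℕ.∸ 1
    ℓ = blockSize π β ℕ.∸ 1

  π₁ π₂ π₃ π₄ : SetPartition n
  π₁ = act j p π
  π₂ x = if isUV x then 0 else if (π x ≡ᵇ α) ∨ (π x ≡ᵇ β) then 1 else suc (suc (π x))
  π₃ x = if isUV x ∨ (π x ≡ᵇ α) then 0 else if π x ≡ᵇ β then 1 else suc (suc (π x))
  π₄ x = if isUV x ∨ (π x ≡ᵇ β) then 0 else if π x ≡ᵇ α then 1 else suc (suc (π x))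

  σ : LinComb n
  σ = (1ℚ , π₁) ∷ (1ℚ , π₂) ∷
      ((if ℓ ≡ᵇ 1 then [] else ((- 1ℚ , π₃) ∷ [])) ++
       (if k ≡ᵇ 1 then [] else ((- 1ℚ , π₄) ∷ [])))

{-# OPTIONS --safe #-}

-- Write u, v for the swapped elements i, i+1 and α, β for their blocks.  Since s_i(π) is noncrossing
-- and s_i preserves the order of every pair other than (u, v), each crossing of π has u, v as two
-- consecutive of its four points; hence α ≠ β and both blocks have further elements.  Every πₖ occurring
-- in σ_i(π) agrees with π outside α ∪ β and splits α ∪ β into two non-singleton blocks, which gives the
-- counts.  π₂ is noncrossing because no block of π₁ separates two elements of the union of the blocks of
-- the neighbours u, v; π₃ and π₄ arise from π₁ by moving u, resp. v, into the block of its neighbour.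
-- If π also crosses at i′ > i, every crossing passes through both swapped pairs.  Either i′ = i + 1 and
-- α = {i, i+2}: then σ_{i′}(π) has the terms of σ_i(π), with π₁, π₂ exchanged and π₃ matched with π′₄;
-- or α = {i, i′} and β = {i+1, i′+1}: then both sums reduce to the same π₁ + π₂.

module Submission where

open import Level using (0ℓ)
open import Function using (_∘_; id; flip)
open import Function.Bundles using (_⇔_; mk⇔; module Equivalence)
open import Function.Properties.Equivalence using () renaming (sym to ⇔-sym)
open import Data.Empty using (⊥; ⊥-elim)
open import Data.Bool as Bool using (Bool; true; false; if_then_else_)
open import Data.Bool.Properties using (∨-zeroʳ)
open import Data.Nat as ℕ using (ℕ; zero; suc; _+_; _∸_; _≤_; _<_; s≤s; z≤n)
open import Data.Nat.Properties
  using (<-cmp; <-irrelevant; 0≢1+n; 1+n≢n; suc-injective; +-suc; n<1+n; <⇒≱; <-asym; <-trans; <-irrefl;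
         ≤∧≢⇒<; ≤-pred)
open import Data.Fin as F using (Fin; toℕ; fromℕ<)
import Data.Fin.Properties as FP
open import Data.Product as Product using (_×_; _,_; ∃; proj₁; proj₂; uncurry)
open import Data.Sum as Sum using (_⊎_; inj₁; inj₂; [_,_]′)
open import Data.List using ([]; _∷_; _++_; length; filter; tabulate; allFin)
open import Data.List.Properties using (++-identityʳ)
open import Data.List.Relation.Unary.All using (All; []; _∷_)
open import Data.List.Relation.Unary.All.Properties using (++⁺)
open import Data.List.Relation.Binary.Pointwise using (Pointwise; []; _∷_)
open import Data.Rational using (ℚ; 0ℚ; 1ℚ; -_) renaming (_+_ to _+ℚ_)
import Data.Rational.Properties as ℚ
open import Algebra.Bundles using (CommutativeMonoid)
open import Algebra.Properties.CommutativeSemigroup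
  (CommutativeMonoid.commutativeSemigroup ℚ.+-0-commutativeMonoid) using (x∙yz≈y∙xz)
open import Relation.Nullary using (¬_; Dec; yes; no; does; contradiction)
open import Relation.Nullary.Decidable
  using (_×-dec_; _⊎-dec_; ¬?; _→-dec_; ⌊_⌋; dec-true; dec-false; does-⇔; isYes≗does)
open import Relation.Unary using (Pred; Decidable; _≐_; U)
open import Relation.Unary.Properties using (_∩?_; ∁?)
open import Relation.Binary.Definitions using (tri<; tri≈; tri>)
open import Relation.Binary.PropositionalEquality
  using (_≡_; _≢_; _≗_; ≢-sym; refl; sym; trans; cong; cong₂; subst; subst₂; module ≡-Reasoning)
open Equivalence using (to; from)
open ≡-Reasoning

open import Defs

isYes⇒ : ∀ {A : Set} (a? : Dec A) → ⌊ a? ⌋ ≡ true → A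
isYes⇒ (yes a) _ = a

⇒isYes : ∀ {A : Set} (a? : Dec A) → A → ⌊ a? ⌋ ≡ true
⇒isYes a? a = trans (isYes≗does a?) (dec-true a? a)

isYes-⇔ : ∀ {A B : Set} → A ⇔ B → (a? : Dec A) (b? : Dec B) → ⌊ a? ⌋ ≡ ⌊ b? ⌋
isYes-⇔ A⇔B a? b? = trans (isYes≗does a?) (trans (does-⇔ A⇔B a? b?) (sym (isYes≗does b?)))

isNo⇒ : ∀ {A : Set} (a? : Dec A) → ¬ A → ⌊ a? ⌋ ≡ false
isNo⇒ a? ¬a = trans (isYes≗does a?) (dec-false a? ¬a)

¬→⇒ : ∀ {A B : Set} → Dec A → ¬ (A → B) → A × ¬ B
¬→⇒ (yes a) ¬a→b = a , λ b → ¬a→b (λ _ → b)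
¬→⇒ (no ¬a) ¬a→b = contradiction (λ a → contradiction a ¬a) ¬a→b

contradiction₃ : ∀ {P Q R : Set} → P ⊎ Q ⊎ R → ¬ P → ¬ Q → ¬ R → ⊥
contradiction₃ p⊎q⊎r ¬p ¬q ¬r = [ ¬p , [ ¬q , ¬r ]′ ]′ p⊎q⊎r

count : ∀ {n} {P : Pred (Fin n) 0ℓ} → Decidable P → ℕ
count {zero}  P? = 0
count {suc n} P? = (if does (P? F.zero) then 1 else 0) + count (P? ∘ F.suc)

module _ {A : Set} {P : Pred A 0ℓ} (P? : Decidable P) where

  length-filter-tabulate : ∀ {n} (f : Fin n → A) → length (filter P? (tabulate f)) ≡ count (P? ∘ f)
  length-filter-tabulate {zero}  f = refl
  length-filter-tabulate {suc n} f with P? (f F.zero)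
  ... | yes _ = cong suc (length-filter-tabulate (f ∘ F.suc))
  ... | no _  = length-filter-tabulate (f ∘ F.suc)

length-filter-allFin : ∀ {n} {P : Pred (Fin n) 0ℓ} (P? : Decidable P) → length (filter P? (allFin n)) ≡ count P?
length-filter-allFin {n} P? = length-filter-tabulate P? (id {A = Fin n})

count-cong : ∀ {n} {P Q : Pred (Fin n) 0ℓ} (P? : Decidable P) (Q? : Decidable Q) → P ≐ Q → count P? ≡ count Q?
count-cong {zero}  P? Q? P≐Q = refl
count-cong {suc n} P? Q? (P⊆Q , Q⊆P) with P? F.zero | Q? F.zero
... | yes _ | yes _  = cong suc (count-cong (P? ∘ F.suc) (Q? ∘ F.suc) (P⊆Q , Q⊆P))
... | no _  | no _   = count-cong (P? ∘ F.suc) (Q? ∘ F.suc) (P⊆Q , Q⊆P)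
... | yes p | no ¬q  = contradiction (P⊆Q p) ¬q
... | no ¬p | yes q  = contradiction (Q⊆P q) ¬p

count-none : ∀ {n} {P : Pred (Fin n) 0ℓ} (P? : Decidable P) → (∀ x → ¬ P x) → count P? ≡ 0
count-none {zero}  P? ¬P = refl
count-none {suc n} P? ¬P with P? F.zero
... | yes p = contradiction p (¬P F.zero)
... | no _  = count-none (P? ∘ F.suc) (¬P ∘ F.suc)

count-split : ∀ {n} {P Q : Pred (Fin n) 0ℓ} (P? : Decidable P) (Q? : Decidable Q) →
  count P? ≡ count (P? ∩? Q?) + count (P? ∩? ∁? Q?)
count-split {zero}  P? Q? = refl
count-split {suc n} P? Q? with P? F.zero | Q? F.zero
... | yes _ | yes _ = cong suc (count-split (P? ∘ F.suc) (Q? ∘ F.suc))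
... | yes _ | no _  = trans (cong suc (count-split (P? ∘ F.suc) (Q? ∘ F.suc))) (sym (+-suc _ _))
... | no _  | _     = count-split (P? ∘ F.suc) (Q? ∘ F.suc)

count-≡ : ∀ {n} (a : Fin n) → count (F._≟ a) ≡ 1
count-≡ {suc n} F.zero = cong suc (count-none (λ (x : Fin n) → F.suc x F.≟ F.zero) λ x ())
count-≡ (F.suc a)      = trans (count-cong _ (F._≟ a) (FP.suc-injective , cong F.suc)) (count-≡ a)

count-pick : ∀ {n} {P : Pred (Fin n) 0ℓ} (P? : Decidable P) {a} → P a →
  count P? ≡ suc (count (P? ∩? ∁? (F._≟ a)))
count-pick P? {a} Pa = trans (count-split P? (F._≟ a))
  (cong (_+ count (P? ∩? ∁? (F._≟ a)))
        (trans (count-cong (P? ∩? (F._≟ a)) (F._≟ a) (proj₂ , λ { refl → Pa , refl })) (count-≡ a)))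

count-pair : ∀ {n} {P : Pred (Fin n) 0ℓ} (P? : Decidable P) {a b} → a ≢ b → P a → P b →
  (∀ {x} → P x → x ≡ a ⊎ x ≡ b) → count P? ≡ 2
count-pair P? {a} {b} a≢b Pa Pb onlyAB =
  trans (count-pick P? Pa) (cong suc (trans (count-pick (P? ∩? ∁? (F._≟ a)) (Pb , a≢b ∘ sym))
    (cong suc (count-none ((P? ∩? ∁? (F._≟ a)) ∩? ∁? (F._≟ b))
                          λ { x ((Px , x≢a) , x≢b) → [ x≢a , x≢b ]′ (onlyAB Px) }))))

count-≥2 : ∀ {n} {P : Pred (Fin n) 0ℓ} (P? : Decidable P) {a b} → a ≢ b → P a → P b → 2 ≤ count P?
count-≥2 P? {a} a≢b Pa Pb rewrite count-pick P? Pa | count-pick (P? ∩? ∁? (F._≟ a)) (Pb , a≢b ∘ sym) =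
  s≤s (s≤s z≤n)

Least : ∀ {n} → Pred (Fin n) 0ℓ → Pred (Fin n) 0ℓ
Least X x = X x × (∀ y → y F.< x → ¬ X y)

least? : ∀ {n} {X : Pred (Fin n) 0ℓ} → Decidable X → Decidable (Least X)
least? X? x = X? x ×-dec FP.all? (λ y → y F.<? x →-dec ¬? (X? y))

count-least : ∀ {n} {X : Pred (Fin n) 0ℓ} (X? : Decidable X) (L? : Decidable (Least X)) → ∃ X → count L? ≡ 1
count-least {suc n} {X} X? L? (w , Xw) with L? F.zero
... | yes (X0 , _) = cong suc (count-none (L? ∘ F.suc) λ x (_ , minimal) → minimal F.zero (s≤s z≤n) X0)
... | no ¬L0 with w
...   | F.zero   = contradiction (Xw , λ _ ()) ¬L0
...   | F.suc w′ = trans (count-cong (L? ∘ F.suc) (least? (X? ∘ F.suc)) (shift , unshift))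
                         (count-least (X? ∘ F.suc) (least? (X? ∘ F.suc)) (w′ , Xw))
  where
  ¬X0 : ¬ X F.zero
  ¬X0 X0 = ¬L0 (X0 , λ _ ())
  shift : ∀ {x} → Least X (F.suc x) → Least (X ∘ F.suc) x
  shift (Xx , minimal) = Xx , λ y y<x → minimal (F.suc y) (s≤s y<x)
  unshift : ∀ {x} → Least (X ∘ F.suc) x → Least X (F.suc x)
  unshift (Xx , minimal) = Xx , λ { F.zero _ → ¬X0 ; (F.suc y) (s≤s y<x) → minimal y y<x }

-- Set partitions up to relabelling

module _ {n : ℕ} where

  SameBlockOf : SetPartition n → SetPartition n → Fin n → Set
  SameBlockOf τ ρ x = ∀ y → τ y ≡ τ x ⇔ ρ y ≡ ρ x

  _≈ₚ_ : SetPartition n → SetPartition n → Set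
  τ ≈ₚ ρ = ∀ x → SameBlockOf τ ρ x

  infix 4 _≈ₚ_

  SameBlockOf-sym : ∀ {τ ρ x} → SameBlockOf τ ρ x → SameBlockOf ρ τ x
  SameBlockOf-sym same y = ⇔-sym (same y)

  ≈ₚ-sym : ∀ {τ ρ} → τ ≈ₚ ρ → ρ ≈ₚ τ
  ≈ₚ-sym τ≈ρ x = SameBlockOf-sym (τ≈ρ x)

  ≗⇒≈ₚ : ∀ {τ ρ} → τ ≗ ρ → τ ≈ₚ ρ
  ≗⇒≈ₚ τ≗ρ x y = mk⇔ (λ e → trans (sym (τ≗ρ y)) (trans e (τ≗ρ x)))
                     (λ e → trans (τ≗ρ y) (trans e (sym (τ≗ρ x))))

  relabel-on : ∀ {D : Pred (Fin n) 0ℓ} {τ ρ : SetPartition n} (f g : ℕ → ℕ) →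
    (∀ {x} → D x → τ x ≡ f (ρ x)) → (∀ {x} → D x → ρ x ≡ g (τ x)) →
    ∀ {x y} → D x → D y → τ x ≡ τ y ⇔ ρ x ≡ ρ y
  relabel-on f g τ≡fρ ρ≡gτ Dx Dy =
    mk⇔ (λ e → trans (ρ≡gτ Dx) (trans (cong g e) (sym (ρ≡gτ Dy))))
        (λ e → trans (τ≡fρ Dx) (trans (cong f e) (sym (τ≡fρ Dy))))

  relabel-≈ₚ : ∀ {τ ρ} (f g : ℕ → ℕ) → (∀ x → τ x ≡ f (ρ x)) → (∀ x → ρ x ≡ g (τ x)) → τ ≈ₚ ρ
  relabel-≈ₚ f g τ≡fρ ρ≡gτ x y = relabel-on {D = U} f g (λ {z} _ → τ≡fρ z) (λ {z} _ → ρ≡gτ z) {y} {x} _ _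

  ≈ₚ-by-involution : ∀ {τ ρ} (f : ℕ → ℕ) → (∀ m → f (f m) ≡ m) → (∀ x → τ x ≡ f (ρ x)) → τ ≈ₚ ρ
  ≈ₚ-by-involution {ρ = ρ} f f∘f≡id τ≡fρ =
    relabel-≈ₚ f f τ≡fρ (λ x → trans (sym (f∘f≡id (ρ x))) (cong f (sym (τ≡fρ x))))

  NonCrossing-resp : ∀ {τ ρ} → τ ≈ₚ ρ → NonCrossing τ → NonCrossing ρ
  NonCrossing-resp τ≈ρ nc a b c d a<b b<c c<d a~c b~d =
    to (τ≈ρ b a) (nc a b c d a<b b<c c<d (from (τ≈ρ c a) a~c) (from (τ≈ρ d b) b~d))

  IsBlockMin : SetPartition n → Pred (Fin n) 0ℓ
  IsBlockMin τ x = ∀ y → y F.< x → τ y ≢ τ x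

  isBlockMin? : (τ : SetPartition n) → Decidable (IsBlockMin τ)
  isBlockMin? τ x = FP.all? (λ y → y F.<? x →-dec ¬? (τ y ℕ.≟ τ x))

  IsSingleton : SetPartition n → Pred (Fin n) 0ℓ
  IsSingleton τ x = blockSize τ (τ x) ≡ 1

  isSingleton? : (τ : SetPartition n) → Decidable (IsSingleton τ)
  isSingleton? τ x = blockSize τ (τ x) ℕ.≟ 1

  numBlocks-count : ∀ (τ : SetPartition n) → numBlocks τ ≡ count (isBlockMin? τ)
  numBlocks-count τ = length-filter-allFin (isBlockMin? τ)

  numSingletons-count : ∀ (τ : SetPartition n) → numSingletons τ ≡ count (isSingleton? τ)
  numSingletons-count τ = length-filter-allFin (isSingleton? τ)

  blockSize-count : ∀ (τ : SetPartition n) c → blockSize τ c ≡ count (λ x → τ x ℕ.≟ c)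
  blockSize-count τ c = length-filter-allFin (λ x → τ x ℕ.≟ c)

  blockSize-cong : ∀ {τ ρ x} → SameBlockOf τ ρ x → blockSize τ (τ x) ≡ blockSize ρ (ρ x)
  blockSize-cong {τ} {ρ} {x} same = begin
    blockSize τ (τ x)                   ≡⟨ blockSize-count τ (τ x) ⟩
    count (λ y → τ y ℕ.≟ τ x)           ≡⟨ count-cong (λ y → τ y ℕ.≟ τ x) (λ y → ρ y ℕ.≟ ρ x)
                                              ((λ {y} → to (same y)) , (λ {y} → from (same y))) ⟩
    count (λ y → ρ y ℕ.≟ ρ x)           ≡⟨ sym (blockSize-count ρ (ρ x)) ⟩
    blockSize ρ (ρ x)                   ∎

  isBlockMin-cong : ∀ {τ ρ x} → SameBlockOf τ ρ x → IsBlockMin τ x → IsBlockMin ρ x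
  isBlockMin-cong same min y y<x e = min y y<x (from (same y) e)

  numBlocks-resp : ∀ {τ ρ} → τ ≈ₚ ρ → numBlocks τ ≡ numBlocks ρ
  numBlocks-resp {τ} {ρ} τ≈ρ = begin
    numBlocks τ               ≡⟨ numBlocks-count τ ⟩
    count (isBlockMin? τ)     ≡⟨ count-cong _ _ ((λ {x} → isBlockMin-cong (τ≈ρ x)) ,
                                                 (λ {x} → isBlockMin-cong (≈ₚ-sym τ≈ρ x))) ⟩
    count (isBlockMin? ρ)     ≡⟨ sym (numBlocks-count ρ) ⟩
    numBlocks ρ               ∎

  numSingletons-resp : ∀ {τ ρ} → τ ≈ₚ ρ → numSingletons τ ≡ numSingletons ρ
  numSingletons-resp {τ} {ρ} τ≈ρ = begin
    numSingletons τ           ≡⟨ numSingletons-count τ ⟩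
    count (isSingleton? τ)    ≡⟨ count-cong _ _ ((λ {x} → trans (sym (blockSize-cong (τ≈ρ x)))) ,
                                                 (λ {x} → trans (blockSize-cong (τ≈ρ x)))) ⟩
    count (isSingleton? ρ)    ≡⟨ sym (numSingletons-count ρ) ⟩
    numSingletons ρ           ∎

  AgreeOff : Pred (Fin n) 0ℓ → SetPartition n → SetPartition n → Set
  AgreeOff G τ ρ = ∀ {x} → ¬ G x → SameBlockOf τ ρ x

  record TwoBlocksOn (τ : SetPartition n) (G : Pred (Fin n) 0ℓ) : Set where
    field
      r₀ r₁    : Fin n
      distinct : τ r₀ ≢ τ r₁
      cover    : ∀ {x} → G x → τ x ≡ τ r₀ ⊎ τ x ≡ τ r₁
      closed   : ∀ {x} → τ x ≡ τ r₀ ⊎ τ x ≡ τ r₁ → G x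

  AllPaired : SetPartition n → Pred (Fin n) 0ℓ → Set
  AllPaired τ G = ∀ {x} → G x → ∃ λ y → y ≢ x × τ y ≡ τ x

  blockMin⇒least : ∀ {τ x c} → IsBlockMin τ x → τ x ≡ c → Least (λ y → τ y ≡ c) x
  blockMin⇒least min refl = refl , min

  least⇒blockMin : ∀ {τ x c} → Least (λ y → τ y ≡ c) x → IsBlockMin τ x
  least⇒blockMin (refl , least) = least

  count-blockMins-two : ∀ {τ G} (G? : Decidable G) → TwoBlocksOn τ G → count (isBlockMin? τ ∩? G?) ≡ 2
  count-blockMins-two {τ} G? tb = begin
    count (isBlockMin? τ ∩? G?)
      ≡⟨ count-split (isBlockMin? τ ∩? G?) in₀? ⟩
    count ((isBlockMin? τ ∩? G?) ∩? in₀?) + count ((isBlockMin? τ ∩? G?) ∩? ∁? in₀?)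
      ≡⟨ cong₂ _+_ (count-cong _ (least? in₀?) (first , first⁻¹)) (count-cong _ (least? in₁?) (second , second⁻¹)) ⟩
    count (least? in₀?) + count (least? in₁?)
      ≡⟨ cong₂ _+_ (count-least in₀? (least? in₀?) (r₀ , refl)) (count-least in₁? (least? in₁?) (r₁ , refl)) ⟩
    2 ∎
    where
    open TwoBlocksOn tb
    in₀? in₁? : Decidable (λ x → τ x ≡ τ _)
    in₀? x = τ x ℕ.≟ τ r₀
    in₁? x = τ x ℕ.≟ τ r₁
    first : ∀ {x} → (IsBlockMin τ x × _) × τ x ≡ τ r₀ → Least (λ y → τ y ≡ τ r₀) x
    first ((min , _) , e) = blockMin⇒least min e
    first⁻¹ : ∀ {x} → Least (λ y → τ y ≡ τ r₀) x → (IsBlockMin τ x × _) × τ x ≡ τ r₀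
    first⁻¹ l@(e , _) = (least⇒blockMin l , closed (inj₁ e)) , e
    second : ∀ {x} → (IsBlockMin τ x × _) × τ x ≢ τ r₀ → Least (λ y → τ y ≡ τ r₁) x
    second ((min , g) , ¬e) = blockMin⇒least min ([ (λ e → contradiction e ¬e) , id ]′ (cover g))
    second⁻¹ : ∀ {x} → Least (λ y → τ y ≡ τ r₁) x → (IsBlockMin τ x × _) × τ x ≢ τ r₀
    second⁻¹ l@(e , _) = (least⇒blockMin l , closed (inj₂ e)) , λ e₀ → distinct (trans (sym e₀) e)

  numBlocks-twoBlocks : ∀ {τ ρ G} (G? : Decidable G) → TwoBlocksOn τ G → TwoBlocksOn ρ G → AgreeOff G τ ρ →
    numBlocks τ ≡ numBlocks ρ
  numBlocks-twoBlocks {τ} {ρ} G? tbτ tbρ agree = begin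
    numBlocks τ
      ≡⟨ trans (numBlocks-count τ) (count-split (isBlockMin? τ) G?) ⟩
    count (isBlockMin? τ ∩? G?) + count (isBlockMin? τ ∩? ∁? G?)
      ≡⟨ cong₂ _+_ (trans (count-blockMins-two G? tbτ) (sym (count-blockMins-two G? tbρ)))
                   (count-cong (isBlockMin? τ ∩? ∁? G?) (isBlockMin? ρ ∩? ∁? G?)
                     ((λ (min , g) → isBlockMin-cong (agree g) min , g) ,
                      (λ (min , g) → isBlockMin-cong (SameBlockOf-sym (agree g)) min , g))) ⟩
    count (isBlockMin? ρ ∩? G?) + count (isBlockMin? ρ ∩? ∁? G?)
      ≡⟨ sym (trans (numBlocks-count ρ) (count-split (isBlockMin? ρ) G?)) ⟩
    numBlocks ρ ∎

  paired⇒¬singleton : ∀ {τ x y} → y ≢ x → τ y ≡ τ x → ¬ IsSingleton τ x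
  paired⇒¬singleton {τ} {x} y≢x τy≡τx single = 2≰1 (subst (2 ≤_) size≡1 two≤size)
    where
    two≤size : 2 ≤ count (λ z → τ z ℕ.≟ τ x)
    two≤size = count-≥2 (λ z → τ z ℕ.≟ τ x) (y≢x ∘ sym) refl τy≡τx
    size≡1 : count (λ z → τ z ℕ.≟ τ x) ≡ 1
    size≡1 = trans (sym (blockSize-count τ (τ x))) single
    2≰1 : ¬ 2 ≤ 1
    2≰1 (s≤s ())

  count-singletons-none : ∀ {τ G} (G? : Decidable G) → AllPaired τ G → count (isSingleton? τ ∩? G?) ≡ 0
  count-singletons-none {τ} G? paired = count-none (isSingleton? τ ∩? G?) λ x (single , g) →
    let (y , y≢x , τy≡τx) = paired g in paired⇒¬singleton y≢x τy≡τx single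

  numSingletons-paired : ∀ {τ ρ G} (G? : Decidable G) → AllPaired τ G → AllPaired ρ G → AgreeOff G τ ρ →
    numSingletons τ ≡ numSingletons ρ
  numSingletons-paired {τ} {ρ} G? pairedτ pairedρ agree = begin
    numSingletons τ
      ≡⟨ trans (numSingletons-count τ) (count-split (isSingleton? τ) G?) ⟩
    count (isSingleton? τ ∩? G?) + count (isSingleton? τ ∩? ∁? G?)
      ≡⟨ cong₂ _+_ (trans (count-singletons-none G? pairedτ) (sym (count-singletons-none G? pairedρ)))
                   (count-cong (isSingleton? τ ∩? ∁? G?) (isSingleton? ρ ∩? ∁? G?)
                     ((λ (single , g) → trans (sym (blockSize-cong (agree g))) single , g) ,
                      (λ (single , g) → trans (blockSize-cong (agree g)) single , g))) ⟩
    count (isSingleton? ρ ∩? G?) + count (isSingleton? ρ ∩? ∁? G?)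
      ≡⟨ sym (trans (numSingletons-count ρ) (count-split (isSingleton? ρ) G?)) ⟩
    numSingletons ρ ∎

  label-≢ : ∀ {τ : SetPartition n} {x y} → τ x ≢ τ y → x ≢ y
  label-≢ {τ} τx≢τy x≡y = τx≢τy (cong τ x≡y)

  blockSize-pair : ∀ {τ : SetPartition n} {c x y} → τ x ≡ c → τ y ≡ c → x ≢ y →
    (∀ {z} → τ z ≡ c → z ≡ x ⊎ z ≡ y) → blockSize τ c ≡ 2
  blockSize-pair {τ} {c} τx τy x≢y only = trans (blockSize-count τ c) (count-pair (λ z → τ z ℕ.≟ c) x≢y τx τy only)

  third-member : ∀ {τ : SetPartition n} {c x y} → τ x ≡ c → τ y ≡ c → x ≢ y → blockSize τ c ≢ 2 →
    ∃ λ z → z ≢ x × z ≢ y × τ z ≡ c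
  third-member {τ} {c} {x} {y} τx τy x≢y size≢2
    with FP.any? (λ z → ¬? (z F.≟ x) ×-dec ¬? (z F.≟ y) ×-dec τ z ℕ.≟ c)
  ... | yes (z , z≢x , z≢y , τz) = z , z≢x , z≢y , τz
  ... | no ∄z = ⊥-elim (size≢2 (blockSize-pair τx τy x≢y only-x-y))
    where
    only-x-y : ∀ {z} → τ z ≡ c → z ≡ x ⊎ z ≡ y
    only-x-y {z} τz with z F.≟ x | z F.≟ y
    ... | yes z≡x | _       = inj₁ z≡x
    ... | no _    | yes z≡y = inj₂ z≡y
    ... | no z≢x  | no z≢y  = contradiction (z , z≢x , z≢y , τz) ∄z

  sameKernel-sound : ∀ {τ ρ} → sameKernel τ ρ ≡ true → τ ≈ₚ ρ
  sameKernel-sound {τ} {ρ} same x y = mk⇔ (transfer τ ρ (bits y x)) (transfer ρ τ (sym (bits y x)))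
    where
    bits : ∀ a b → (τ a ≡ᵇ τ b) ≡ (ρ a ≡ᵇ ρ b)
    bits = isYes⇒ (FP.all? λ a → FP.all? λ b → (τ a ≡ᵇ τ b) Bool.≟ (ρ a ≡ᵇ ρ b)) same
    transfer : ∀ (κ λ′ : SetPartition n) → (κ y ≡ᵇ κ x) ≡ (λ′ y ≡ᵇ λ′ x) → κ y ≡ κ x → λ′ y ≡ λ′ x
    transfer κ λ′ bit e = isYes⇒ (λ′ y ℕ.≟ λ′ x) (trans (sym bit) (⇒isYes (κ y ℕ.≟ κ x) e))

  sameKernel-resp : ∀ {τ τ′} ρ → τ ≈ₚ τ′ → sameKernel τ ρ ≡ sameKernel τ′ ρ
  sameKernel-resp {τ} {τ′} ρ τ≈τ′ = isYes-⇔ (mk⇔ (λ h a b → trans (sym (bits a b)) (h a b))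
                                                (λ h a b → trans (bits a b) (h a b)))
    (FP.all? λ a → FP.all? λ b → (τ a ≡ᵇ τ b) Bool.≟ (ρ a ≡ᵇ ρ b))
    (FP.all? λ a → FP.all? λ b → (τ′ a ≡ᵇ τ′ b) Bool.≟ (ρ a ≡ᵇ ρ b))
    where
    bits : ∀ a b → (τ a ≡ᵇ τ b) ≡ (τ′ a ≡ᵇ τ′ b)
    bits a b = isYes-⇔ (τ≈τ′ b a) (τ a ℕ.≟ τ b) (τ′ a ℕ.≟ τ′ b)

-- pack a b is the labelling scheme of π₂, π₃, π₄ in Defs: the two regrouped blocks get labels 0, 1
opaque
  pack : ℕ → ℕ → ℕ → ℕ
  pack a b m = if m ≡ᵇ a then 0 else if m ≡ᵇ b then 1 else suc (suc m)

  transpose : ℕ → ℕ → ℕ → ℕ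
  transpose a b m = if m ≡ᵇ a then b else if m ≡ᵇ b then a else m

unpack : ℕ → ℕ → ℕ → ℕ
unpack a b 0             = a
unpack a b 1             = b
unpack a b (suc (suc m)) = m

opaque
  unfolding pack transpose

  pack-a : ∀ {a b} → pack a b a ≡ 0
  pack-a {a} rewrite ⇒isYes (a ℕ.≟ a) refl = refl

  pack-b : ∀ {a b} → a ≢ b → pack a b b ≡ 1
  pack-b {a} {b} a≢b rewrite isNo⇒ (b ℕ.≟ a) (≢-sym a≢b) | ⇒isYes (b ℕ.≟ b) refl = refl

  pack-other : ∀ {a b m} → m ≢ a → m ≢ b → pack a b m ≡ suc (suc m)
  pack-other {a} {b} {m} m≢a m≢b rewrite isNo⇒ (m ℕ.≟ a) m≢a | isNo⇒ (m ℕ.≟ b) m≢b = refl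

  transpose-a : ∀ {a b} → transpose a b a ≡ b
  transpose-a {a} rewrite ⇒isYes (a ℕ.≟ a) refl = refl

  transpose-b : ∀ {a b} → a ≢ b → transpose a b b ≡ a
  transpose-b {a} {b} a≢b rewrite isNo⇒ (b ℕ.≟ a) (≢-sym a≢b) | ⇒isYes (b ℕ.≟ b) refl = refl

  transpose-other : ∀ {a b m} → m ≢ a → m ≢ b → transpose a b m ≡ m
  transpose-other {a} {b} {m} m≢a m≢b rewrite isNo⇒ (m ℕ.≟ a) m≢a | isNo⇒ (m ℕ.≟ b) m≢b = refl

transpose-involutive : ∀ {a b} → a ≢ b → ∀ m → transpose a b (transpose a b m) ≡ m
transpose-involutive {a} {b} a≢b m with m ℕ.≟ a | m ℕ.≟ b
... | yes refl | _       = trans (cong (transpose a b) transpose-a) (transpose-b a≢b)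
... | no _     | yes refl = trans (cong (transpose a b) (transpose-b a≢b)) transpose-a
... | no m≢a   | no m≢b  = trans (cong (transpose a b) (transpose-other m≢a m≢b)) (transpose-other m≢a m≢b)

≡-via : ∀ {k m a c} (g : ℕ → ℕ) → k ≡ a → g c ≡ a → m ≡ c → k ≡ g m
≡-via g k≡a gc≡a m≡c = trans k≡a (trans (sym gc≡a) (cong g (sym m≡c)))

coeff-≢0 : ∀ {n} {P : Pred (SetPartition n) 0ℓ} → (∀ {τ ρ} → τ ≈ₚ ρ → P τ → P ρ) →
  ∀ {L : LinComb n} {ρ} → All (P ∘ proj₂) L → coeff L ρ ≢ 0ℚ → P ρ
coeff-≢0 resp {[]} [] nz = contradiction refl nz
coeff-≢0 resp {(c , τ) ∷ L} {ρ} (Pτ ∷ PL) nz with sameKernel τ ρ in same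
... | true  = resp (sameKernel-sound same) Pτ
... | false = coeff-≢0 resp PL (nz ∘ trans (ℚ.+-identityˡ (coeff L ρ)))

All-if : ∀ {A : Set} {P : Pred A 0ℓ} {b xs} → (b ≡ false → All P xs) → All P (if b then [] else xs)
All-if {b = true}  _   = []
All-if {b = false} Pxs = Pxs refl

_≈ₜ_ : ∀ {n} → ℚ × SetPartition n → ℚ × SetPartition n → Set
(c , τ) ≈ₜ (c′ , τ′) = c ≡ c′ × τ ≈ₚ τ′

coeff-cong : ∀ {n} {L L′ : LinComb n} ρ → Pointwise _≈ₜ_ L L′ → coeff L ρ ≡ coeff L′ ρ
coeff-cong ρ [] = refl
coeff-cong {L = (c , τ) ∷ _} ρ ((refl , τ≈τ′) ∷ L≈L′) =
  cong₂ _+ℚ_ (cong (λ b → if b then c else 0ℚ) (sameKernel-resp ρ τ≈τ′)) (coeff-cong ρ L≈L′)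

if-pointwise : ∀ {n} {b b′ c} {τ τ′ : SetPartition n} → b ≡ b′ → τ ≈ₚ τ′ →
  Pointwise _≈ₜ_ (if b then [] else (c , τ) ∷ []) (if b′ then [] else (c , τ′) ∷ [])
if-pointwise {b = true}  refl _     = []
if-pointwise {b = false} refl τ≈τ′ = (refl , τ≈τ′) ∷ []

coeff-swap : ∀ {n} t t′ (L : LinComb n) ρ → coeff (t ∷ t′ ∷ L) ρ ≡ coeff (t′ ∷ t ∷ L) ρ
coeff-swap (c , τ) (c′ , τ′) L ρ =
  x∙yz≈y∙xz (if sameKernel τ ρ then c else 0ℚ) (if sameKernel τ′ ρ then c′ else 0ℚ) (coeff L ρ)

-- Separation and moves in noncrossing partitions

module _ {n : ℕ} where

  Adjacent : Fin n → Fin n → Set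
  Adjacent x y = toℕ y ≡ suc (toℕ x)

  adjacent-< : ∀ {x y} → Adjacent x y → x F.< y
  adjacent-< {x} x⋯y = subst (toℕ x ℕ.<_) (sym x⋯y) (n<1+n (toℕ x))

  adjacent-nothing-between : ∀ {x y z : Fin n} → Adjacent x y → x F.< z → z F.< y → ⊥
  adjacent-nothing-between {z = z} x⋯y x<z z<y = <⇒≱ (subst (toℕ z ℕ.<_) x⋯y z<y) x<z

  Between : Fin n → Fin n → Fin n → Set
  Between c x y = (x F.< c × c F.< y) ⊎ (y F.< c × c F.< x)

  Outside : Fin n → Fin n → Fin n → Set
  Outside c x y = (c F.< x × c F.< y) ⊎ (x F.< c × y F.< c)

  Outside-sym : ∀ {c x y} → Outside c x y → Outside c y x
  Outside-sym = Sum.map Product.swap Product.swap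

  Separates : SetPartition n → ℕ → Fin n → Fin n → Set
  Separates ρ γ x y = ∃ λ (c : Fin n) → ∃ λ (c′ : Fin n) → ρ c ≡ γ × ρ c′ ≡ γ × Between c x y × Outside c′ x y

  separates-sym : ∀ {ρ γ x y} → Separates ρ γ x y → Separates ρ γ y x
  separates-sym (c , c′ , ρc , ρc′ , between , outside) =
    c , c′ , ρc , ρc′ , Sum.swap between , Outside-sym outside

  ¬separates-refl : ∀ {ρ γ x} → ¬ Separates ρ γ x x
  ¬separates-refl (_ , _ , _ , _ , between , _) = [ uncurry <-asym , uncurry <-asym ]′ between

  ¬separates-adjacent : ∀ {ρ γ x y} → Adjacent x y → ¬ Separates ρ γ x y
  ¬separates-adjacent x⋯y (_ , _ , _ , _ , inj₁ (x<c , c<y) , _) = adjacent-nothing-between x⋯y x<c c<y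
  ¬separates-adjacent x⋯y (_ , _ , _ , _ , inj₂ (y<c , c<x) , _) = <-asym c<x (<-trans (adjacent-< x⋯y) y<c)

  module _ {ρ : SetPartition n} (nc : NonCrossing ρ) {γ : ℕ} where

    private
      ¬separates-sameBlock-< : ∀ {x y c c′} → ρ x ≡ ρ y → ρ x ≢ γ → ρ c ≡ γ → ρ c′ ≡ γ →
        x F.< c → c F.< y → Outside c′ x y → ⊥
      ¬separates-sameBlock-< x~y ρx≢γ ρc ρc′ x<c c<y (inj₁ (c′<x , _)) =
        ρx≢γ (trans (sym (nc _ _ _ _ c′<x x<c c<y (trans ρc′ (sym ρc)) x~y)) ρc′)
      ¬separates-sameBlock-< x~y ρx≢γ ρc ρc′ x<c c<y (inj₂ (_ , y<c′)) =
        ρx≢γ (trans (nc _ _ _ _ x<c c<y y<c′ x~y (trans ρc (sym ρc′))) ρc)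

    ¬separates-sameBlock : ∀ {x y} → ρ x ≡ ρ y → ρ x ≢ γ → ¬ Separates ρ γ x y
    ¬separates-sameBlock x~y ρx≢γ (_ , _ , ρc , ρc′ , inj₁ (x<c , c<y) , outside) =
      ¬separates-sameBlock-< x~y ρx≢γ ρc ρc′ x<c c<y outside
    ¬separates-sameBlock x~y ρx≢γ (_ , _ , ρc , ρc′ , inj₂ (y<c , c<x) , outside) =
      ¬separates-sameBlock-< (sym x~y) (ρx≢γ ∘ trans x~y) ρc ρc′ y<c c<x (Outside-sym outside)

  private
    split-< : ∀ {ρ γ x y z c c′} → ρ y ≢ γ → ρ c ≡ γ → ρ c′ ≡ γ → x F.< c → c F.< z → Outside c′ x z →
              Separates ρ γ x y ⊎ Separates ρ γ y z
    split-< {y = y} {c = c} {c′} ρy≢γ ρc ρc′ x<c c<z outside with FP.<-cmp y c | outside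
    ... | tri≈ _ refl _ | _ = contradiction ρc ρy≢γ
    ... | tri< y<c _ _ | inj₂ (_ , z<c′) =
      inj₂ (c , c′ , ρc , ρc′ , inj₁ (y<c , c<z) , inj₂ (<-trans y<c (<-trans c<z z<c′) , z<c′))
    ... | tri> _ _ c<y | inj₁ (c′<x , _) =
      inj₁ (c , c′ , ρc , ρc′ , inj₁ (x<c , c<y) , inj₁ (c′<x , <-trans c′<x (<-trans x<c c<y)))
    ... | tri< y<c _ _ | inj₁ (c′<x , c′<z) with FP.<-cmp c′ y
    ...   | tri< c′<y _ _ = inj₂ (c , c′ , ρc , ρc′ , inj₁ (y<c , c<z) , inj₁ (c′<y , c′<z))
    ...   | tri≈ _ refl _ = contradiction ρc′ ρy≢γ
    ...   | tri> _ _ y<c′ = inj₁ (c′ , c , ρc′ , ρc , inj₂ (y<c′ , c′<x) , inj₂ (x<c , y<c))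
    split-< {y = y} {c = c} {c′} ρy≢γ ρc ρc′ x<c c<z outside | tri> _ _ c<y | inj₂ (x<c′ , z<c′) with FP.<-cmp c′ y
    ...   | tri< c′<y _ _ = inj₂ (c′ , c , ρc′ , ρc , inj₂ (z<c′ , c′<y) , inj₁ (c<y , c<z))
    ...   | tri≈ _ refl _ = contradiction ρc′ ρy≢γ
    ...   | tri> _ _ y<c′ = inj₁ (c , c′ , ρc , ρc′ , inj₁ (x<c , c<y) , inj₂ (x<c′ , y<c′))

  separates-split : ∀ {ρ γ x y z} → ρ y ≢ γ → Separates ρ γ x z → Separates ρ γ x y ⊎ Separates ρ γ y z
  separates-split ρy≢γ (_ , _ , ρc , ρc′ , inj₁ (x<c , c<z) , outside) = split-< ρy≢γ ρc ρc′ x<c c<z outside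
  separates-split ρy≢γ (_ , _ , ρc , ρc′ , inj₂ (z<c , c<x) , outside) =
    Sum.swap (Sum.map separates-sym separates-sym (split-< ρy≢γ ρc ρc′ z<c c<x (Outside-sym outside)))

  module _ {ρ : SetPartition n} (nc : NonCrossing ρ) {u v} (u⋯v : Adjacent u v)
           {γ : ℕ} (ρu≢γ : ρ u ≢ γ) (ρv≢γ : ρ v ≢ γ) where

    private
      anchor : ∀ {x} → ρ x ≡ ρ u ⊎ ρ x ≡ ρ v → ∃ λ w → (w ≡ u ⊎ w ≡ v) × ρ x ≡ ρ w
      anchor (inj₁ x~u) = u , inj₁ refl , x~u
      anchor (inj₂ x~v) = v , inj₂ refl , x~v

      anchor≢γ : ∀ {w} → w ≡ u ⊎ w ≡ v → ρ w ≢ γ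
      anchor≢γ (inj₁ refl) = ρu≢γ
      anchor≢γ (inj₂ refl) = ρv≢γ

      ¬separates-anchors : ∀ {w w′} → w ≡ u ⊎ w ≡ v → w′ ≡ u ⊎ w′ ≡ v → ¬ Separates ρ γ w w′
      ¬separates-anchors (inj₁ refl) (inj₁ refl) = ¬separates-refl
      ¬separates-anchors (inj₁ refl) (inj₂ refl) = ¬separates-adjacent u⋯v
      ¬separates-anchors (inj₂ refl) (inj₁ refl) = ¬separates-adjacent u⋯v ∘ separates-sym
      ¬separates-anchors (inj₂ refl) (inj₂ refl) = ¬separates-refl

    ¬separates-adjacentBlocks : ∀ {x y} → ρ x ≡ ρ u ⊎ ρ x ≡ ρ v → ρ y ≡ ρ u ⊎ ρ y ≡ ρ v → ¬ Separates ρ γ x y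
    ¬separates-adjacentBlocks x∈ y∈ x|y
      with (w , w∈ , x~w) ← anchor x∈ | (w′ , w′∈ , y~w′) ← anchor y∈
      with separates-split (anchor≢γ w∈) x|y
    ... | inj₁ x|w = ¬separates-sameBlock nc x~w (anchor≢γ w∈ ∘ trans (sym x~w)) x|w
    ... | inj₂ w|y with separates-split (anchor≢γ w′∈) w|y
    ...   | inj₁ w|w′ = ¬separates-anchors w∈ w′∈ w|w′
    ...   | inj₂ w′|y = ¬separates-sameBlock nc y~w′ (anchor≢γ w′∈ ∘ trans (sym y~w′)) (separates-sym w′|y)

  Neighbours : Fin n → Fin n → Set
  Neighbours w t = Adjacent w t ⊎ Adjacent t w

  neighbours-≢ : ∀ {w t} → Neighbours w t → t ≢ w
  neighbours-≢ (inj₁ w⋯t) refl = <-irrefl refl (adjacent-< w⋯t)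
  neighbours-≢ (inj₂ t⋯w) refl = <-irrefl refl (adjacent-< t⋯w)

  below-neighbour : ∀ {w t x} → Neighbours w t → x F.< w → x ≢ t → x F.< t
  below-neighbour (inj₁ w⋯t) x<w _   = <-trans x<w (adjacent-< w⋯t)
  below-neighbour (inj₂ t⋯w) x<w x≢t = ≤∧≢⇒< (≤-pred (subst (_ ℕ.<_) t⋯w x<w)) (x≢t ∘ FP.toℕ-injective)

  above-neighbour : ∀ {w t x} → Neighbours w t → w F.< x → x ≢ t → t F.< x
  above-neighbour (inj₁ w⋯t) w<x x≢t = ≤∧≢⇒< (subst (ℕ._≤ _) (sym w⋯t) w<x) (x≢t ∘ FP.toℕ-injective ∘ sym)
  above-neighbour (inj₂ t⋯w) w<x _   = <-trans (adjacent-< t⋯w) w<x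

  noncrossing-move : ∀ {ρ τ : SetPartition n} {w t} → NonCrossing ρ → Neighbours w t → τ w ≡ τ t →
    (∀ {x y} → x ≢ w → y ≢ w → τ x ≡ τ y ⇔ ρ x ≡ ρ y) → NonCrossing τ
  noncrossing-move {ρ} {τ} {w} {t} nc w~t τw≡τt agree = nc′
    where
    t≢w : t ≢ w
    t≢w = neighbours-≢ w~t

    >⇒≢ : ∀ {x y : Fin n} → x F.< y → y ≢ x
    >⇒≢ x<y refl = <-irrefl refl x<y

    away : ∀ a b c d → a ≢ w → b ≢ w → c ≢ w → d ≢ w → a F.< b → b F.< c → c F.< d →
      τ a ≡ τ c → τ b ≡ τ d → τ a ≡ τ b
    away a b c d a≢w b≢w c≢w d≢w a<b b<c c<d a~c b~d = from (agree a≢w b≢w)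
      (nc a b c d a<b b<c c<d (to (agree a≢w c≢w) a~c) (to (agree b≢w d≢w) b~d))

    nc′ : NonCrossing τ
    nc′ a b c d a<b b<c c<d a~c b~d with a F.≟ w | b F.≟ w | c F.≟ w | d F.≟ w
    ... | no a≢w | no b≢w | no c≢w | no d≢w = away a b c d a≢w b≢w c≢w d≢w a<b b<c c<d a~c b~d
    ... | yes refl | _ | _ | _ with b F.≟ t
    ...   | yes refl = τw≡τt
    ...   | no b≢t = trans τw≡τt
      (away t b c d t≢w (>⇒≢ a<b) (>⇒≢ (<-trans a<b b<c)) (>⇒≢ (<-trans a<b (<-trans b<c c<d)))
            (above-neighbour w~t a<b b≢t) b<c c<d (trans (sym τw≡τt) a~c) b~d)
    nc′ a b c d a<b b<c c<d a~c b~d | no a≢w | yes refl | _ | _ with a F.≟ t | c F.≟ t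
    ...   | yes refl | _ = sym τw≡τt
    ...   | no _ | yes refl = trans a~c (sym τw≡τt)
    ...   | no a≢t | no c≢t = trans
      (away a t c d a≢w t≢w (>⇒≢ b<c) (>⇒≢ (<-trans b<c c<d))
            (below-neighbour w~t a<b a≢t) (above-neighbour w~t b<c c≢t) c<d a~c (trans (sym τw≡τt) b~d))
      (sym τw≡τt)
    nc′ a b c d a<b b<c c<d a~c b~d | no a≢w | no b≢w | yes refl | _ with b F.≟ t | d F.≟ t
    ...   | yes refl | _ = trans a~c τw≡τt
    ...   | no _ | yes refl = trans a~c (trans τw≡τt (sym b~d))
    ...   | no b≢t | no d≢t = away a b t d a≢w b≢w t≢w (>⇒≢ c<d)
                              a<b (below-neighbour w~t b<c b≢t) (above-neighbour w~t c<d d≢t) (trans a~c τw≡τt) b~d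
    nc′ a b c d a<b b<c c<d a~c b~d | no a≢w | no b≢w | no c≢w | yes refl with c F.≟ t
    ...   | yes refl = trans a~c (trans (sym τw≡τt) (sym b~d))
    ...   | no c≢t = away a b c t a≢w b≢w c≢w t≢w a<b b<c (below-neighbour w~t c<d c≢t) a~c (trans b~d τw≡τt)

-- Crossings through a swapped pair, and the terms of σ_i(π)

record Crossing {n} (π : SetPartition n) : Set where
  field
    a b c d : Fin n
    a<b : a F.< b
    b<c : b F.< c
    c<d : c F.< d
    a~c : π a ≡ π c
    b~d : π b ≡ π d
    a≁b : π a ≢ π b

private
  noCross? : ∀ {n} (π : SetPartition n) a b c d →
    Dec (a F.< b → b F.< c → c F.< d → π a ≡ π c → π b ≡ π d → π a ≡ π b)
  noCross? π a b c d = a F.<? b →-dec (b F.<? c →-dec (c F.<? d →-dec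
                       (π a ℕ.≟ π c →-dec (π b ℕ.≟ π d →-dec π a ℕ.≟ π b))))

opaque
  ¬noncrossing⇒crossing : ∀ {n} {π : SetPartition n} → ¬ NonCrossing π → Crossing π
  ¬noncrossing⇒crossing {n} {π} ¬nc
    with (a , ¬∀b) ← FP.¬∀⟶∃¬ n _ (λ a → FP.all? λ b → FP.all? λ c → FP.all? λ d → noCross? π a b c d) ¬nc
    with (b , ¬∀c) ← FP.¬∀⟶∃¬ n _ (λ b → FP.all? λ c → FP.all? λ d → noCross? π a b c d) ¬∀b
    with (c , ¬∀d) ← FP.¬∀⟶∃¬ n _ (λ c → FP.all? λ d → noCross? π a b c d) ¬∀c
    with (d , ¬noCross) ← FP.¬∀⟶∃¬ n _ (noCross? π a b c) ¬∀d
    with (a<b , ¬₁) ← ¬→⇒ (a F.<? b) ¬noCross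
    with (b<c , ¬₂) ← ¬→⇒ (b F.<? c) ¬₁
    with (c<d , ¬₃) ← ¬→⇒ (c F.<? d) ¬₂
    with (a~c , ¬₄) ← ¬→⇒ (π a ℕ.≟ π c) ¬₃
    with (b~d , a≁b) ← ¬→⇒ (π b ℕ.≟ π d) ¬₄
    = record { a<b = a<b ; b<c = b<c ; c<d = c<d ; a~c = a~c ; b~d = b~d ; a≁b = a≁b }

Admissible : ∀ {n} → SetPartition n → SetPartition n → Set
Admissible π ρ = NonCrossing ρ × numBlocks ρ ≡ numBlocks π × numSingletons ρ ≡ numSingletons π

admissible-resp : ∀ {n} {π τ ρ : SetPartition n} → τ ≈ₚ ρ → Admissible π τ → Admissible π ρ
admissible-resp τ≈ρ (nc , blocks , singletons) =
  NonCrossing-resp τ≈ρ nc , trans (sym (numBlocks-resp τ≈ρ)) blocks , trans (sym (numSingletons-resp τ≈ρ)) singletons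

module Swap {n} (π : SetPartition n) (j : ℕ) (p : suc j < n) where

  u v : Fin n
  u = s j p (fromℕ< p)
  v = fromℕ< p

  α β : ℕ
  α = π u
  β = π v

  opaque
    τ₁ τ₂ τ₃ τ₄ : SetPartition n
    τ₁ = π₁ π j p
    τ₂ = π₂ π j p
    τ₃ = π₃ π j p
    τ₄ = π₄ π j p

  toℕ-v : toℕ v ≡ suc j
  toℕ-v = FP.toℕ-fromℕ< p

  private
    s-at-j : ∀ x → toℕ x ≡ j → s j p x ≡ v
    s-at-j x x≡j with toℕ x ℕ.≟ j
    ... | yes _   = refl
    ... | no x≢j  = contradiction x≡j x≢j

    toℕ-s-at-1+j : ∀ x → toℕ x ≡ suc j → toℕ (s j p x) ≡ j
    toℕ-s-at-1+j x x≡1+j with toℕ x ℕ.≟ j | toℕ x ℕ.≟ suc j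
    ... | yes x≡j | _         = contradiction (trans (sym x≡1+j) x≡j) 1+n≢n
    ... | no _    | yes _     = FP.toℕ-fromℕ< _
    ... | no _    | no x≢1+j  = contradiction x≡1+j x≢1+j

    s-elsewhere′ : ∀ x → toℕ x ≢ j → toℕ x ≢ suc j → s j p x ≡ x
    s-elsewhere′ x x≢j x≢1+j with toℕ x ℕ.≟ j | toℕ x ℕ.≟ suc j
    ... | yes x≡j | _         = contradiction x≡j x≢j
    ... | no _    | yes x≡1+j = contradiction x≡1+j x≢1+j
    ... | no _    | no _      = refl

  toℕ-u : toℕ u ≡ j
  toℕ-u = toℕ-s-at-1+j v toℕ-v

  u⋯v : Adjacent u v
  u⋯v = trans toℕ-v (cong suc (sym toℕ-u))

  u≢v : u ≢ v
  u≢v u≡v = 1+n≢n (trans (sym toℕ-v) (trans (cong toℕ (sym u≡v)) toℕ-u))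

  s-u : s j p u ≡ v
  s-u = s-at-j u toℕ-u

  s-v : s j p v ≡ u
  s-v = refl

  s-elsewhere : ∀ {x} → x ≢ u → x ≢ v → s j p x ≡ x
  s-elsewhere {x} x≢u x≢v = s-elsewhere′ x
    (λ x≡j → x≢u (FP.toℕ-injective (trans x≡j (sym toℕ-u))))
    (λ x≡1+j → x≢v (FP.toℕ-injective (trans x≡1+j (sym toℕ-v))))

  data Position (x : Fin n) : Set where
    at-u      : x ≡ u → Position x
    at-v      : x ≡ v → Position x
    elsewhere : x ≢ u → x ≢ v → Position x

  position : ∀ x → Position x
  position x with x F.≟ u | x F.≟ v
  ... | yes x≡u | _       = at-u x≡u
  ... | no _    | yes x≡v = at-v x≡v
  ... | no x≢u  | no x≢v  = elsewhere x≢u x≢v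

  s-involutive : ∀ x → s j p (s j p x) ≡ x
  s-involutive x with position x
  ... | at-u refl = trans (cong (s j p) s-u) s-v
  ... | at-v refl = s-u
  ... | elsewhere x≢u x≢v = trans (cong (s j p) (s-elsewhere x≢u x≢v)) (s-elsewhere x≢u x≢v)

  SwapPair : Fin n → Fin n → Set
  SwapPair x y = x ≡ u × y ≡ v

  swapPair? : ∀ x y → Dec (SwapPair x y)
  swapPair? x y = x F.≟ u ×-dec y F.≟ v

  s-monotone : ∀ {x y} → x F.< y → ¬ SwapPair x y → s j p x F.< s j p y
  s-monotone {x} {y} x<y not-uv with position x | position y
  ... | at-u refl | at-u refl = contradiction x<y (<-irrefl refl)
  ... | at-u refl | at-v refl = contradiction (refl , refl) not-uv
  ... | at-u refl | elsewhere y≢u y≢v =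
    subst₂ F._<_ (sym s-u) (sym (s-elsewhere y≢u y≢v)) (above-neighbour (inj₁ u⋯v) x<y y≢v)
  ... | at-v refl | at-u refl = contradiction x<y (<-asym (adjacent-< u⋯v))
  ... | at-v refl | at-v refl = contradiction x<y (<-irrefl refl)
  ... | at-v refl | elsewhere y≢u y≢v =
    subst (u F.<_) (sym (s-elsewhere y≢u y≢v)) (<-trans (adjacent-< u⋯v) x<y)
  ... | elsewhere x≢u x≢v | at-u refl =
    subst₂ F._<_ (sym (s-elsewhere x≢u x≢v)) (sym s-u) (<-trans x<y (adjacent-< u⋯v))
  ... | elsewhere x≢u x≢v | at-v refl =
    subst (F._< s j p v) (sym (s-elsewhere x≢u x≢v)) (below-neighbour (inj₂ u⋯v) x<y x≢u)
  ... | elsewhere x≢u x≢v | elsewhere y≢u y≢v =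
    subst₂ F._<_ (sym (s-elsewhere x≢u x≢v)) (sym (s-elsewhere y≢u y≢v)) x<y

  data Role (x : Fin n) : Set where
    is-u  : x ≡ u → Role x
    is-v  : x ≡ v → Role x
    in-α  : x ≢ u → x ≢ v → π x ≡ α → Role x
    in-β  : x ≢ u → x ≢ v → π x ≢ α → π x ≡ β → Role x
    apart : x ≢ u → x ≢ v → π x ≢ α → π x ≢ β → Role x

  role : ∀ x → Role x
  role x with position x
  ... | at-u x≡u = is-u x≡u
  ... | at-v x≡v = is-v x≡v
  ... | elsewhere x≢u x≢v with π x ℕ.≟ α | π x ℕ.≟ β
  ...   | yes x∈α | _       = in-α x≢u x≢v x∈α
  ...   | no x∉α  | yes x∈β = in-β x≢u x≢v x∉α x∈β
  ...   | no x∉α  | no x∉β  = apart x≢u x≢v x∉α x∉β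

  private
    isUV : Fin n → Bool
    isUV x = ⌊ x F.≟ u ⌋ Bool.∨ ⌊ x F.≟ v ⌋

    isUV-u : isUV u ≡ true
    isUV-u rewrite ⇒isYes (u F.≟ u) refl = refl

    isUV-v : isUV v ≡ true
    isUV-v rewrite isNo⇒ (v F.≟ u) (u≢v ∘ sym) | ⇒isYes (v F.≟ v) refl = refl

    isUV-elsewhere : ∀ {x} → x ≢ u → x ≢ v → isUV x ≡ false
    isUV-elsewhere {x} x≢u x≢v rewrite isNo⇒ (x F.≟ u) x≢u | isNo⇒ (x F.≟ v) x≢v = refl

  opaque
    unfolding τ₁ τ₂ τ₃ τ₄

    τ₁-u : τ₁ u ≡ β
    τ₁-u = cong π s-u

    τ₁-v : τ₁ v ≡ α
    τ₁-v = refl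

    τ₁-elsewhere : ∀ {x} → x ≢ u → x ≢ v → τ₁ x ≡ π x
    τ₁-elsewhere x≢u x≢v = cong π (s-elsewhere x≢u x≢v)

    τ₂-u : τ₂ u ≡ 0
    τ₂-u rewrite isUV-u = refl

    τ₂-v : τ₂ v ≡ 0
    τ₂-v rewrite isUV-v = refl

    τ₂-α : ∀ {x} → x ≢ u → x ≢ v → π x ≡ α → τ₂ x ≡ 1
    τ₂-α {x} x≢u x≢v x∈α rewrite isUV-elsewhere x≢u x≢v | ⇒isYes (π x ℕ.≟ α) x∈α = refl

    τ₂-β : ∀ {x} → x ≢ u → x ≢ v → π x ≡ β → τ₂ x ≡ 1
    τ₂-β {x} x≢u x≢v x∈β rewrite isUV-elsewhere x≢u x≢v | ⇒isYes (π x ℕ.≟ β) x∈β | ∨-zeroʳ (π x ≡ᵇ α) = refl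

    τ₂-apart : ∀ {x} → x ≢ u → x ≢ v → π x ≢ α → π x ≢ β → τ₂ x ≡ suc (suc (π x))
    τ₂-apart {x} x≢u x≢v x∉α x∉β
      rewrite isUV-elsewhere x≢u x≢v | isNo⇒ (π x ℕ.≟ α) x∉α | isNo⇒ (π x ℕ.≟ β) x∉β = refl

    τ₃-u : τ₃ u ≡ 0
    τ₃-u rewrite isUV-u = refl

    τ₃-v : τ₃ v ≡ 0
    τ₃-v rewrite isUV-v = refl

    τ₃-α : ∀ {x} → π x ≡ α → τ₃ x ≡ 0
    τ₃-α {x} x∈α rewrite ⇒isYes (π x ℕ.≟ α) x∈α | ∨-zeroʳ (isUV x) = refl

    τ₃-β : ∀ {x} → x ≢ u → x ≢ v → π x ≢ α → π x ≡ β → τ₃ x ≡ 1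
    τ₃-β {x} x≢u x≢v x∉α x∈β
      rewrite isUV-elsewhere x≢u x≢v | isNo⇒ (π x ℕ.≟ α) x∉α | ⇒isYes (π x ℕ.≟ β) x∈β = refl

    τ₃-apart : ∀ {x} → x ≢ u → x ≢ v → π x ≢ α → π x ≢ β → τ₃ x ≡ suc (suc (π x))
    τ₃-apart {x} x≢u x≢v x∉α x∉β
      rewrite isUV-elsewhere x≢u x≢v | isNo⇒ (π x ℕ.≟ α) x∉α | isNo⇒ (π x ℕ.≟ β) x∉β = refl

    τ₄-u : τ₄ u ≡ 0
    τ₄-u rewrite isUV-u = refl

    τ₄-v : τ₄ v ≡ 0
    τ₄-v rewrite isUV-v = refl

    τ₄-β : ∀ {x} → π x ≡ β → τ₄ x ≡ 0
    τ₄-β {x} x∈β rewrite ⇒isYes (π x ℕ.≟ β) x∈β | ∨-zeroʳ (isUV x) = refl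

    τ₄-α : ∀ {x} → x ≢ u → x ≢ v → π x ≢ β → π x ≡ α → τ₄ x ≡ 1
    τ₄-α {x} x≢u x≢v x∉β x∈α
      rewrite isUV-elsewhere x≢u x≢v | isNo⇒ (π x ℕ.≟ β) x∉β | ⇒isYes (π x ℕ.≟ α) x∈α = refl

    τ₄-apart : ∀ {x} → x ≢ u → x ≢ v → π x ≢ α → π x ≢ β → τ₄ x ≡ suc (suc (π x))
    τ₄-apart {x} x≢u x≢v x∉α x∉β
      rewrite isUV-elsewhere x≢u x≢v | isNo⇒ (π x ℕ.≟ β) x∉β | isNo⇒ (π x ℕ.≟ α) x∉α = refl

    τ₁-s : ∀ x → τ₁ (s j p x) ≡ π x
    τ₁-s x = cong π (s-involutive x)

  G : Pred (Fin n) 0ℓ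
  G x = π x ≡ α ⊎ π x ≡ β

  G? : Decidable G
  G? x = π x ℕ.≟ α ⊎-dec π x ℕ.≟ β

  ¬G⇒apart : ∀ {x} → ¬ G x → x ≢ u × x ≢ v × π x ≢ α × π x ≢ β
  ¬G⇒apart ¬Gx = (λ { refl → ¬Gx (inj₁ refl) }) , (λ { refl → ¬Gx (inj₂ refl) }) , ¬Gx ∘ inj₁ , ¬Gx ∘ inj₂

  G⇒¬apart : ∀ {x} → G x → π x ≢ α → π x ≢ β → ⊥
  G⇒¬apart Gx x∉α x∉β = [ x∉α , x∉β ]′ Gx

  twoBlocks-π : α ≢ β → TwoBlocksOn π G
  twoBlocks-π α≢β = record { r₀ = u ; r₁ = v ; distinct = α≢β ; cover = id ; closed = id }

  module Regrouped {τ : SetPartition n} {l₀ l₁ : ℕ} (f : ℕ → ℕ) (f-injective : ∀ {m m′} → f m ≡ f m′ → m ≡ m′)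
    (inside : ∀ {x} → G x → τ x ≡ l₀ ⊎ τ x ≡ l₁)
    (outside : ∀ {x} → ¬ G x → τ x ≡ f (π x) × τ x ≢ l₀ × τ x ≢ l₁) where

    agreeOff : AgreeOff G π τ
    agreeOff {x} ¬Gx y = mk⇔ keep reflect
      where
      keep : π y ≡ π x → τ y ≡ τ x
      keep e with G? y
      ... | yes Gy  = contradiction (subst (λ m → m ≡ α ⊎ m ≡ β) e Gy) ¬Gx
      ... | no ¬Gy = trans (proj₁ (outside ¬Gy)) (trans (cong f e) (sym (proj₁ (outside ¬Gx))))
      reflect : τ y ≡ τ x → π y ≡ π x
      reflect e with G? y
      ... | yes Gy  = ⊥-elim ([ (λ τy≡l₀ → proj₁ (proj₂ (outside ¬Gx)) (trans (sym e) τy≡l₀))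
                              , (λ τy≡l₁ → proj₂ (proj₂ (outside ¬Gx)) (trans (sym e) τy≡l₁)) ]′ (inside Gy))
      ... | no ¬Gy = f-injective (trans (sym (proj₁ (outside ¬Gy))) (trans e (proj₁ (outside ¬Gx))))

    twoBlocks : ∀ {r₀ r₁} → τ r₀ ≡ l₀ → τ r₁ ≡ l₁ → l₀ ≢ l₁ → TwoBlocksOn τ G
    twoBlocks {r₀} {r₁} τr₀ τr₁ l₀≢l₁ = record
      { r₀ = r₀ ; r₁ = r₁
      ; distinct = λ e → l₀≢l₁ (trans (sym τr₀) (trans e τr₁))
      ; cover = Sum.map (λ e → trans e (sym τr₀)) (λ e → trans e (sym τr₁)) ∘ inside
      ; closed = closed }
      where
      closed : ∀ {x} → τ x ≡ τ r₀ ⊎ τ x ≡ τ r₁ → G x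
      closed {x} τx∈ with G? x
      ... | yes Gx = Gx
      ... | no ¬Gx = ⊥-elim ([ (λ e → proj₁ (proj₂ (outside ¬Gx)) (trans e τr₀))
                             , (λ e → proj₂ (proj₂ (outside ¬Gx)) (trans e τr₁)) ]′ τx∈)

  k ℓ : ℕ
  k = blockSize π α ∸ 1
  ℓ = blockSize π β ∸ 1

  opaque
    unfolding τ₁ τ₂ τ₃ τ₄

    σ-terms : σ π j p ≡ (1ℚ , τ₁) ∷ (1ℚ , τ₂) ∷
      ((if ℓ ≡ᵇ 1 then [] else (- 1ℚ , τ₃) ∷ []) ++ (if k ≡ᵇ 1 then [] else (- 1ℚ , τ₄) ∷ []))
    σ-terms = refl

    σ-τ₁τ₂ : (ℓ ≡ᵇ 1) ≡ true → (k ≡ᵇ 1) ≡ true → σ π j p ≡ (1ℚ , τ₁) ∷ (1ℚ , τ₂) ∷ []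
    σ-τ₁τ₂ ℓ≡1 k≡1 rewrite ℓ≡1 | k≡1 = refl

    σ-τ₁τ₂τ₃ : (k ≡ᵇ 1) ≡ true → σ π j p ≡ (1ℚ , τ₁) ∷ (1ℚ , τ₂) ∷ (if ℓ ≡ᵇ 1 then [] else (- 1ℚ , τ₃) ∷ [])
    σ-τ₁τ₂τ₃ k≡1 rewrite k≡1 = cong (λ xs → (1ℚ , τ₁) ∷ (1ℚ , τ₂) ∷ xs) (++-identityʳ _)

    σ-τ₁τ₂τ₄ : (ℓ ≡ᵇ 1) ≡ true → σ π j p ≡ (1ℚ , τ₁) ∷ (1ℚ , τ₂) ∷ (if k ≡ᵇ 1 then [] else (- 1ℚ , τ₄) ∷ [])
    σ-τ₁τ₂τ₄ ℓ≡1 rewrite ℓ≡1 = refl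

    noncrossing-τ₁ : NonCrossing (act j p π) → NonCrossing τ₁
    noncrossing-τ₁ nc = nc

  module Crossed (nc₁ : NonCrossing τ₁) (¬nc : ¬ NonCrossing π) where

    through-swap : ∀ {a b c d} → a F.< b → b F.< c → c F.< d → π a ≡ π c → π b ≡ π d → π a ≢ π b →
      SwapPair a b ⊎ SwapPair b c ⊎ SwapPair c d
    through-swap {a} {b} {c} {d} a<b b<c c<d a~c b~d a≁b with swapPair? a b | swapPair? b c | swapPair? c d
    ... | yes ab | _      | _      = inj₁ ab
    ... | no _   | yes bc | _      = inj₂ (inj₁ bc)
    ... | no _   | no _   | yes cd = inj₂ (inj₂ cd)
    ... | no ¬ab | no ¬bc | no ¬cd = contradiction π-a~b a≁b
      where
      π-a~b : π a ≡ π b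
      π-a~b = trans (sym (τ₁-s a)) (trans
        (nc₁ (s j p a) (s j p b) (s j p c) (s j p d) (s-monotone a<b ¬ab) (s-monotone b<c ¬bc) (s-monotone c<d ¬cd)
             (trans (τ₁-s a) (trans a~c (sym (τ₁-s c)))) (trans (τ₁-s b) (trans b~d (sym (τ₁-s d)))))
        (τ₁-s b))

    X : Crossing π
    X = ¬noncrossing⇒crossing ¬nc

    open Crossing X

    X-through-swap : SwapPair a b ⊎ SwapPair b c ⊎ SwapPair c d
    X-through-swap = through-swap a<b b<c c<d a~c b~d a≁b

    private
      ≢-above : ∀ {x y z : Fin n} → x F.< y → x ≡ z → y ≢ z
      ≢-above x<y x≡z y≡z = FP.<⇒≢ x<y (trans x≡z (sym y≡z))

      ≢-below : ∀ {x y z : Fin n} → x F.< y → y ≡ z → x ≢ z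
      ≢-below x<y y≡z x≡z = FP.<⇒≢ x<y (trans x≡z (sym y≡z))

    α≢β : α ≢ β
    α≢β α≡β with X-through-swap
    ... | inj₁ (a≡u , b≡v)        = a≁b (trans (cong π a≡u) (trans α≡β (cong π (sym b≡v))))
    ... | inj₂ (inj₁ (b≡u , c≡v)) = a≁b (trans a~c (trans (cong π c≡v) (trans (sym α≡β) (cong π (sym b≡u)))))
    ... | inj₂ (inj₂ (c≡u , d≡v)) =
      a≁b (trans a~c (trans (cong π c≡u) (trans α≡β (trans (cong π (sym d≡v)) (sym b~d)))))

    partner-u : ∃ λ x → x ≢ u × π x ≡ α
    partner-u with X-through-swap
    ... | inj₁ (a≡u , _)        = c , ≢-above (<-trans a<b b<c) a≡u , trans (sym a~c) (cong π a≡u)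
    ... | inj₂ (inj₁ (b≡u , _)) = d , ≢-above (<-trans b<c c<d) b≡u , trans (sym b~d) (cong π b≡u)
    ... | inj₂ (inj₂ (c≡u , _)) = a , ≢-below (<-trans a<b b<c) c≡u , trans a~c (cong π c≡u)

    partner-v : ∃ λ x → x ≢ v × π x ≡ β
    partner-v with X-through-swap
    ... | inj₁ (_ , b≡v)        = d , ≢-above (<-trans b<c c<d) b≡v , trans (sym b~d) (cong π b≡v)
    ... | inj₂ (inj₁ (_ , c≡v)) = a , ≢-below (<-trans a<b b<c) c≡v , trans a~c (cong π c≡v)
    ... | inj₂ (inj₂ (_ , d≡v)) = b , ≢-below (<-trans b<c c<d) d≡v , trans b~d (cong π d≡v)

    ∈α⇒≢v : ∀ {x} → π x ≡ α → x ≢ v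
    ∈α⇒≢v x∈α refl = α≢β (sym x∈α)

    ∈β⇒≢u : ∀ {x} → π x ≡ β → x ≢ u
    ∈β⇒≢u x∈β refl = α≢β x∈β

    ∈α⇒∉β : ∀ {x} → π x ≡ α → π x ≢ β
    ∈α⇒∉β x∈α x∈β = α≢β (trans (sym x∈α) x∈β)

    ∈β⇒∉α : ∀ {x} → π x ≡ β → π x ≢ α
    ∈β⇒∉α x∈β x∈α = α≢β (trans (sym x∈α) x∈β)

    a₁ b₁ : Fin n
    a₁ = proj₁ partner-u
    b₁ = proj₁ partner-v

    a₁≢u : a₁ ≢ u
    a₁≢u = proj₁ (proj₂ partner-u)

    a₁∈α : π a₁ ≡ α
    a₁∈α = proj₂ (proj₂ partner-u)

    b₁≢v : b₁ ≢ v
    b₁≢v = proj₁ (proj₂ partner-v)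

    b₁∈β : π b₁ ≡ β
    b₁∈β = proj₂ (proj₂ partner-v)

    data Class₂ (x : Fin n) : Set where
      pair   : x ≡ u ⊎ x ≡ v → τ₂ x ≡ 0 → Class₂ x
      merged : τ₁ x ≡ τ₁ u ⊎ τ₁ x ≡ τ₁ v → τ₂ x ≡ 1 → Class₂ x
      kept   : τ₁ x ≢ τ₁ u → τ₁ x ≢ τ₁ v → τ₂ x ≡ suc (suc (τ₁ x)) → Class₂ x

    class₂ : ∀ x → Class₂ x
    class₂ x with role x
    ... | is-u refl = pair (inj₁ refl) τ₂-u
    ... | is-v refl = pair (inj₂ refl) τ₂-v
    ... | in-α x≢u x≢v x∈α = merged (inj₂ (trans (τ₁-elsewhere x≢u x≢v) (trans x∈α (sym τ₁-v)))) (τ₂-α x≢u x≢v x∈α)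
    ... | in-β x≢u x≢v _ x∈β = merged (inj₁ (trans (τ₁-elsewhere x≢u x≢v) (trans x∈β (sym τ₁-u)))) (τ₂-β x≢u x≢v x∈β)
    ... | apart x≢u x≢v x∉α x∉β =
      kept (λ e → x∉β (trans (sym τ₁x≡πx) (trans e τ₁-u))) (λ e → x∉α (trans (sym τ₁x≡πx) (trans e τ₁-v)))
           (trans (τ₂-apart x≢u x≢v x∉α x∉β) (cong (suc ∘ suc) (sym τ₁x≡πx)))
      where
      τ₁x≡πx : τ₁ x ≡ π x
      τ₁x≡πx = τ₁-elsewhere x≢u x≢v

    pair-nothing-between : ∀ {x y z} → x ≡ u ⊎ x ≡ v → z ≡ u ⊎ z ≡ v → x F.< y → y F.< z → ⊥
    pair-nothing-between (inj₁ refl) (inj₁ refl) x<y y<z = <-asym x<y y<z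
    pair-nothing-between (inj₁ refl) (inj₂ refl) x<y y<z = adjacent-nothing-between u⋯v x<y y<z
    pair-nothing-between (inj₂ refl) (inj₁ refl) x<y y<z = <-asym (adjacent-< u⋯v) (<-trans x<y y<z)
    pair-nothing-between (inj₂ refl) (inj₂ refl) x<y y<z = <-asym x<y y<z

    τ₂≡0 : ∀ {x} → τ₂ x ≡ 0 → x ≡ u ⊎ x ≡ v
    τ₂≡0 {x} e with class₂ x
    ... | pair x∈ _   = x∈
    ... | merged _ e′ = contradiction (trans (sym e′) e) λ ()
    ... | kept _ _ e′ = contradiction (trans (sym e′) e) λ ()

    τ₂≡1 : ∀ {x} → τ₂ x ≡ 1 → τ₁ x ≡ τ₁ u ⊎ τ₁ x ≡ τ₁ v
    τ₂≡1 {x} e with class₂ x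
    ... | pair _ e′     = contradiction (trans (sym e′) e) λ ()
    ... | merged x∈ _   = x∈
    ... | kept _ _ e′   = contradiction (trans (sym e′) e) λ ()

    τ₂≡2+ : ∀ {x m} → τ₂ x ≡ suc (suc m) → τ₁ x ≡ m
    τ₂≡2+ {x} e with class₂ x
    ... | pair _ e′   = contradiction (trans (sym e′) e) λ ()
    ... | merged _ e′ = contradiction (trans (sym e′) e) λ ()
    ... | kept _ _ e′ = suc-injective (suc-injective (trans (sym e′) e))

    noncrossing-τ₂ : NonCrossing τ₂
    noncrossing-τ₂ a b c d a<b b<c c<d a~c b~d with class₂ a | class₂ b
    ... | pair a∈ τ₂a | _ = ⊥-elim (pair-nothing-between a∈ (τ₂≡0 (trans (sym a~c) τ₂a)) a<b b<c)
    ... | _ | pair b∈ τ₂b = ⊥-elim (pair-nothing-between b∈ (τ₂≡0 (trans (sym b~d) τ₂b)) b<c c<d)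
    ... | merged _ τ₂a | merged _ τ₂b = trans τ₂a (sym τ₂b)
    ... | kept _ _ τ₂a | kept _ _ τ₂b =
      trans τ₂a (trans (cong (suc ∘ suc) τ₁-a~b) (sym τ₂b))
      where
      τ₁-a~b : τ₁ a ≡ τ₁ b
      τ₁-a~b = nc₁ a b c d a<b b<c c<d (sym (τ₂≡2+ (trans (sym a~c) τ₂a))) (sym (τ₂≡2+ (trans (sym b~d) τ₂b)))
    ... | merged a∈ τ₂a | kept b≁u b≁v τ₂b =
      ⊥-elim (¬separates-adjacentBlocks nc₁ u⋯v (≢-sym b≁u) (≢-sym b≁v) a∈ (τ₂≡1 (trans (sym a~c) τ₂a))
        (b , d , refl , τ₂≡2+ (trans (sym b~d) τ₂b) , inj₁ (a<b , b<c) , inj₂ (<-trans a<b (<-trans b<c c<d) , c<d)))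
    ... | kept a≁u a≁v τ₂a | merged b∈ τ₂b =
      ⊥-elim (¬separates-adjacentBlocks nc₁ u⋯v (≢-sym a≁u) (≢-sym a≁v) b∈ (τ₂≡1 (trans (sym b~d) τ₂b))
        (c , a , τ₂≡2+ (trans (sym a~c) τ₂a) , refl , inj₁ (b<c , c<d) , inj₁ (a<b , <-trans a<b (<-trans b<c c<d))))

    τ₃-via-τ₁ : ∀ {x} → x ≢ u → τ₃ x ≡ pack α β (τ₁ x)
    τ₃-via-τ₁ {x} x≢u with role x
    ... | is-u x≡u = contradiction x≡u x≢u
    ... | is-v refl = ≡-via (pack α β) τ₃-v pack-a τ₁-v
    ... | in-α x≢u x≢v x∈α = ≡-via (pack α β) (τ₃-α x∈α) pack-a (trans (τ₁-elsewhere x≢u x≢v) x∈α)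
    ... | in-β x≢u x≢v x∉α x∈β =
      ≡-via (pack α β) (τ₃-β x≢u x≢v x∉α x∈β) (pack-b α≢β) (trans (τ₁-elsewhere x≢u x≢v) x∈β)
    ... | apart x≢u x≢v x∉α x∉β =
      ≡-via (pack α β) (τ₃-apart x≢u x≢v x∉α x∉β) (pack-other x∉α x∉β) (τ₁-elsewhere x≢u x≢v)

    τ₁-via-τ₃ : ∀ {x} → x ≢ u → τ₁ x ≡ unpack α β (τ₃ x)
    τ₁-via-τ₃ {x} x≢u with role x
    ... | is-u x≡u = contradiction x≡u x≢u
    ... | is-v refl = ≡-via (unpack α β) τ₁-v refl τ₃-v
    ... | in-α x≢u x≢v x∈α = ≡-via (unpack α β) (trans (τ₁-elsewhere x≢u x≢v) x∈α) refl (τ₃-α x∈α)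
    ... | in-β x≢u x≢v x∉α x∈β = ≡-via (unpack α β) (trans (τ₁-elsewhere x≢u x≢v) x∈β) refl (τ₃-β x≢u x≢v x∉α x∈β)
    ... | apart x≢u x≢v x∉α x∉β = ≡-via (unpack α β) (τ₁-elsewhere x≢u x≢v) refl (τ₃-apart x≢u x≢v x∉α x∉β)

    τ₄-via-τ₁ : ∀ {x} → x ≢ v → τ₄ x ≡ pack β α (τ₁ x)
    τ₄-via-τ₁ {x} x≢v with role x
    ... | is-v x≡v = contradiction x≡v x≢v
    ... | is-u refl = ≡-via (pack β α) τ₄-u pack-a τ₁-u
    ... | in-α x≢u x≢v x∈α =
      ≡-via (pack β α) (τ₄-α x≢u x≢v (∈α⇒∉β x∈α) x∈α) (pack-b (α≢β ∘ sym)) (trans (τ₁-elsewhere x≢u x≢v) x∈α)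
    ... | in-β x≢u x≢v _ x∈β = ≡-via (pack β α) (τ₄-β x∈β) pack-a (trans (τ₁-elsewhere x≢u x≢v) x∈β)
    ... | apart x≢u x≢v x∉α x∉β =
      ≡-via (pack β α) (τ₄-apart x≢u x≢v x∉α x∉β) (pack-other x∉β x∉α) (τ₁-elsewhere x≢u x≢v)

    τ₁-via-τ₄ : ∀ {x} → x ≢ v → τ₁ x ≡ unpack β α (τ₄ x)
    τ₁-via-τ₄ {x} x≢v with role x
    ... | is-v x≡v = contradiction x≡v x≢v
    ... | is-u refl = ≡-via (unpack β α) τ₁-u refl τ₄-u
    ... | in-α x≢u x≢v x∈α =
      ≡-via (unpack β α) (trans (τ₁-elsewhere x≢u x≢v) x∈α) refl (τ₄-α x≢u x≢v (∈α⇒∉β x∈α) x∈α)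
    ... | in-β x≢u x≢v _ x∈β = ≡-via (unpack β α) (trans (τ₁-elsewhere x≢u x≢v) x∈β) refl (τ₄-β x∈β)
    ... | apart x≢u x≢v x∉α x∉β = ≡-via (unpack β α) (τ₁-elsewhere x≢u x≢v) refl (τ₄-apart x≢u x≢v x∉α x∉β)

    noncrossing-τ₃ : NonCrossing τ₃
    noncrossing-τ₃ = noncrossing-move nc₁ (inj₁ u⋯v) (trans τ₃-u (sym τ₃-v))
      (relabel-on {D = _≢ u} (pack α β) (unpack α β) τ₃-via-τ₁ τ₁-via-τ₃)

    noncrossing-τ₄ : NonCrossing τ₄
    noncrossing-τ₄ = noncrossing-move nc₁ (inj₂ u⋯v) (trans τ₄-v (sym τ₄-u))
      (relabel-on {D = _≢ v} (pack β α) (unpack β α) τ₄-via-τ₁ τ₁-via-τ₄)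

    inside₁ : ∀ {x} → G x → τ₁ x ≡ β ⊎ τ₁ x ≡ α
    inside₁ {x} Gx with role x
    ... | is-u refl = inj₁ τ₁-u
    ... | is-v refl = inj₂ τ₁-v
    ... | in-α x≢u x≢v x∈α = inj₂ (trans (τ₁-elsewhere x≢u x≢v) x∈α)
    ... | in-β x≢u x≢v _ x∈β = inj₁ (trans (τ₁-elsewhere x≢u x≢v) x∈β)
    ... | apart _ _ x∉α x∉β = ⊥-elim (G⇒¬apart Gx x∉α x∉β)

    inside₂ : ∀ {x} → G x → τ₂ x ≡ 0 ⊎ τ₂ x ≡ 1
    inside₂ {x} Gx with role x
    ... | is-u refl = inj₁ τ₂-u
    ... | is-v refl = inj₁ τ₂-v
    ... | in-α x≢u x≢v x∈α = inj₂ (τ₂-α x≢u x≢v x∈α)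
    ... | in-β x≢u x≢v _ x∈β = inj₂ (τ₂-β x≢u x≢v x∈β)
    ... | apart _ _ x∉α x∉β = ⊥-elim (G⇒¬apart Gx x∉α x∉β)

    inside₃ : ∀ {x} → G x → τ₃ x ≡ 0 ⊎ τ₃ x ≡ 1
    inside₃ {x} Gx with role x
    ... | is-u refl = inj₁ τ₃-u
    ... | is-v refl = inj₁ τ₃-v
    ... | in-α _ _ x∈α = inj₁ (τ₃-α x∈α)
    ... | in-β x≢u x≢v x∉α x∈β = inj₂ (τ₃-β x≢u x≢v x∉α x∈β)
    ... | apart _ _ x∉α x∉β = ⊥-elim (G⇒¬apart Gx x∉α x∉β)

    inside₄ : ∀ {x} → G x → τ₄ x ≡ 0 ⊎ τ₄ x ≡ 1
    inside₄ {x} Gx with role x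
    ... | is-u refl = inj₁ τ₄-u
    ... | is-v refl = inj₁ τ₄-v
    ... | in-α x≢u x≢v x∈α = inj₂ (τ₄-α x≢u x≢v (∈α⇒∉β x∈α) x∈α)
    ... | in-β _ _ _ x∈β = inj₁ (τ₄-β x∈β)
    ... | apart _ _ x∉α x∉β = ⊥-elim (G⇒¬apart Gx x∉α x∉β)

    outside₁ : ∀ {x} → ¬ G x → τ₁ x ≡ π x × τ₁ x ≢ β × τ₁ x ≢ α
    outside₁ ¬Gx =
      let (x≢u , x≢v , x∉α , x∉β) = ¬G⇒apart ¬Gx
          τ₁x≡πx = τ₁-elsewhere x≢u x≢v
      in τ₁x≡πx , x∉β ∘ trans (sym τ₁x≡πx) , x∉α ∘ trans (sym τ₁x≡πx)

    outside-shifted : ∀ {τ : SetPartition n} → (∀ {x} → x ≢ u → x ≢ v → π x ≢ α → π x ≢ β → τ x ≡ suc (suc (π x))) →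
      ∀ {x} → ¬ G x → τ x ≡ suc (suc (π x)) × τ x ≢ 0 × τ x ≢ 1
    outside-shifted τ-apart ¬Gx =
      let (x≢u , x≢v , x∉α , x∉β) = ¬G⇒apart ¬Gx
          τx≡2+πx = τ-apart x≢u x≢v x∉α x∉β
      in τx≡2+πx , (λ τx≡0 → 0≢1+n (trans (sym τx≡0) τx≡2+πx))
                 , (λ τx≡1 → 0≢1+n (suc-injective (trans (sym τx≡1) τx≡2+πx)))

    module R₁ = Regrouped {τ = τ₁} id id inside₁ outside₁
    module R₂ = Regrouped {τ = τ₂} {0} {1} (λ m → suc (suc m)) (λ e → suc-injective (suc-injective e)) inside₂
      (outside-shifted {τ = τ₂} τ₂-apart)
    module R₃ = Regrouped {τ = τ₃} {0} {1} (λ m → suc (suc m)) (λ e → suc-injective (suc-injective e)) inside₃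
      (outside-shifted {τ = τ₃} τ₃-apart)
    module R₄ = Regrouped {τ = τ₄} {0} {1} (λ m → suc (suc m)) (λ e → suc-injective (suc-injective e)) inside₄
      (outside-shifted {τ = τ₄} τ₄-apart)

    paired-π : AllPaired π G
    paired-π {x} Gx with role x
    ... | is-u refl = a₁ , a₁≢u , a₁∈α
    ... | is-v refl = b₁ , b₁≢v , b₁∈β
    ... | in-α x≢u _ x∈α = u , ≢-sym x≢u , sym x∈α
    ... | in-β _ x≢v _ x∈β = v , ≢-sym x≢v , sym x∈β
    ... | apart _ _ x∉α x∉β = ⊥-elim (G⇒¬apart Gx x∉α x∉β)

    paired-τ₁ : AllPaired τ₁ G
    paired-τ₁ {x} Gx with role x
    ... | is-u refl = b₁ , ∈β⇒≢u b₁∈β , trans (τ₁-elsewhere (∈β⇒≢u b₁∈β) b₁≢v) (trans b₁∈β (sym τ₁-u))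
    ... | is-v refl = a₁ , ∈α⇒≢v a₁∈α , trans (τ₁-elsewhere a₁≢u (∈α⇒≢v a₁∈α)) (trans a₁∈α (sym τ₁-v))
    ... | in-α x≢u x≢v x∈α = v , ≢-sym x≢v , trans τ₁-v (sym (trans (τ₁-elsewhere x≢u x≢v) x∈α))
    ... | in-β x≢u x≢v _ x∈β = u , ≢-sym x≢u , trans τ₁-u (sym (trans (τ₁-elsewhere x≢u x≢v) x∈β))
    ... | apart _ _ x∉α x∉β = ⊥-elim (G⇒¬apart Gx x∉α x∉β)

    another-merged : ∀ {x} → τ₂ x ≡ 1 → ∃ λ y → y ≢ x × τ₂ y ≡ τ₂ x
    another-merged {x} τ₂x≡1 with x F.≟ a₁
    ... | yes refl = b₁ , (λ b₁≡a₁ → ∈α⇒∉β a₁∈α (subst (λ z → π z ≡ β) b₁≡a₁ b₁∈β))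
                        , trans (τ₂-β (∈β⇒≢u b₁∈β) b₁≢v b₁∈β) (sym τ₂x≡1)
    ... | no x≢a₁  = a₁ , ≢-sym x≢a₁ , trans (τ₂-α a₁≢u (∈α⇒≢v a₁∈α) a₁∈α) (sym τ₂x≡1)

    paired-τ₂ : AllPaired τ₂ G
    paired-τ₂ {x} Gx with role x
    ... | is-u refl = v , ≢-sym u≢v , trans τ₂-v (sym τ₂-u)
    ... | is-v refl = u , u≢v , trans τ₂-u (sym τ₂-v)
    ... | in-α x≢u x≢v x∈α = another-merged (τ₂-α x≢u x≢v x∈α)
    ... | in-β x≢u x≢v _ x∈β = another-merged (τ₂-β x≢u x≢v x∈β)
    ... | apart _ _ x∉α x∉β = ⊥-elim (G⇒¬apart Gx x∉α x∉β)

    paired-τ₃ : blockSize π β ≢ 2 → AllPaired τ₃ G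
    paired-τ₃ size≢2 {x} Gx with role x
    ... | is-u refl = v , ≢-sym u≢v , trans τ₃-v (sym τ₃-u)
    ... | is-v refl = u , u≢v , trans τ₃-u (sym τ₃-v)
    ... | in-α x≢u _ x∈α = u , ≢-sym x≢u , trans τ₃-u (sym (τ₃-α x∈α))
    ... | in-β x≢u x≢v x∉α x∈β =
      let (z , z≢v , z≢x , z∈β) = third-member {τ = π} refl x∈β (≢-sym x≢v) size≢2
      in z , z≢x , trans (τ₃-β (∈β⇒≢u z∈β) z≢v (∈β⇒∉α z∈β) z∈β) (sym (τ₃-β x≢u x≢v x∉α x∈β))
    ... | apart _ _ x∉α x∉β = ⊥-elim (G⇒¬apart Gx x∉α x∉β)

    paired-τ₄ : blockSize π α ≢ 2 → AllPaired τ₄ G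
    paired-τ₄ size≢2 {x} Gx with role x
    ... | is-u refl = v , ≢-sym u≢v , trans τ₄-v (sym τ₄-u)
    ... | is-v refl = u , u≢v , trans τ₄-u (sym τ₄-v)
    ... | in-β x≢u _ _ x∈β = u , ≢-sym x≢u , trans τ₄-u (sym (τ₄-β x∈β))
    ... | in-α x≢u x≢v x∈α =
      let (z , z≢u , z≢x , z∈α) = third-member {τ = π} refl x∈α (≢-sym x≢u) size≢2
      in z , z≢x , trans (τ₄-α z≢u (∈α⇒≢v z∈α) (∈α⇒∉β z∈α) z∈α) (sym (τ₄-α x≢u x≢v (∈α⇒∉β x∈α) x∈α))
    ... | apart _ _ x∉α x∉β = ⊥-elim (G⇒¬apart Gx x∉α x∉β)

    admissible : ∀ {τ} → NonCrossing τ → TwoBlocksOn τ G → AgreeOff G π τ → AllPaired τ G → Admissible π τ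
    admissible nc twoBlocks agree paired =
      nc , sym (numBlocks-twoBlocks G? (twoBlocks-π α≢β) twoBlocks agree)
         , sym (numSingletons-paired G? paired-π paired agree)

    admissible-τ₁ : Admissible π τ₁
    admissible-τ₁ = admissible nc₁ (R₁.twoBlocks τ₁-u τ₁-v (α≢β ∘ sym)) R₁.agreeOff paired-τ₁

    admissible-τ₂ : Admissible π τ₂
    admissible-τ₂ = admissible noncrossing-τ₂ (R₂.twoBlocks τ₂-u (τ₂-α a₁≢u (∈α⇒≢v a₁∈α) a₁∈α) λ ())
      R₂.agreeOff paired-τ₂

    admissible-τ₃ : blockSize π β ≢ 2 → Admissible π τ₃
    admissible-τ₃ size≢2 = admissible noncrossing-τ₃
      (R₃.twoBlocks τ₃-u (τ₃-β (∈β⇒≢u b₁∈β) b₁≢v (∈β⇒∉α b₁∈β) b₁∈β) λ ()) R₃.agreeOff (paired-τ₃ size≢2)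

    admissible-τ₄ : blockSize π α ≢ 2 → Admissible π τ₄
    admissible-τ₄ size≢2 = admissible noncrossing-τ₄
      (R₄.twoBlocks τ₄-u (τ₄-α a₁≢u (∈α⇒≢v a₁∈α) (∈α⇒∉β a₁∈α) a₁∈α) λ ()) R₄.agreeOff (paired-τ₄ size≢2)

    all-admissible : All (Admissible π ∘ proj₂) (σ π j p)
    all-admissible rewrite σ-terms =
      admissible-τ₁ ∷ admissible-τ₂ ∷
      ++⁺ (All-if λ ℓ≢1 → admissible-τ₃ (size≢2 ℓ≢1) ∷ []) (All-if λ k≢1 → admissible-τ₄ (size≢2 k≢1) ∷ [])
      where
      size≢2 : ∀ {m} → ((m ∸ 1) ≡ᵇ 1) ≡ false → m ≢ 2
      size≢2 m∸1≢1 refl = contradiction m∸1≢1 λ ()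

σ-support-admissible : ∀ {n} (π : SetPartition n) j (p : suc j < n) → CrossesAt π j p →
  ∀ ρ → coeff (σ π j p) ρ ≢ 0ℚ → Admissible π ρ
σ-support-admissible π j p (¬nc , nc) ρ = coeff-≢0 admissible-resp all-admissible
  where open Swap π j p
        open Crossed (noncrossing-τ₁ nc) ¬nc

-- Independence of the crossing index

module TwoSwaps {n} (π : SetPartition n) {j j′ : ℕ} (p : suc j < n) (p′ : suc j′ < n) (j<j′ : j < j′)
  (¬nc : ¬ NonCrossing π) (nc : NonCrossing (act j p π)) (nc′ : NonCrossing (act j′ p′ π)) where

  module A = Swap π j p
  module B = Swap π j′ p′
  module A× = A.Crossed (A.noncrossing-τ₁ nc) ¬nc
  module B× = B.Crossed (B.noncrossing-τ₁ nc′) ¬nc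
  open A using (u; v; α; β)
  open B using () renaming (u to u′; v to v′)
  open A× using (α≢β)

  u<u′ : u F.< u′
  u<u′ = subst₂ ℕ._<_ (sym A.toℕ-u) (sym B.toℕ-u) j<j′

  data Shape : Set where
    consecutive : u′ ≡ v → π v′ ≡ α → (e : Fin n) → π e ≡ β → e F.< u ⊎ v′ F.< e → Shape
    separated   : v F.< u′ → π u′ ≡ α → π v′ ≡ β → Shape

  module _ where
    open Crossing A×.X

    shape : Shape
    shape with A×.X-through-swap | B×.X-through-swap
    ... | inj₁ (a≡u , _) | inj₁ (a≡u′ , _) = ⊥-elim (FP.<⇒≢ u<u′ (trans (sym a≡u) a≡u′))
    ... | inj₁ (a≡u , b≡v) | inj₂ (inj₁ (b≡u′ , c≡v′)) =
      consecutive (trans (sym b≡u′) b≡v) (trans (cong π (sym c≡v′)) (trans (sym a~c) (cong π a≡u)))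
        d (trans (sym b~d) (cong π b≡v)) (inj₂ (subst (F._< d) c≡v′ c<d))
    ... | inj₁ (a≡u , b≡v) | inj₂ (inj₂ (c≡u′ , d≡v′)) =
      separated (subst₂ F._<_ b≡v c≡u′ b<c) (trans (cong π (sym c≡u′)) (trans (sym a~c) (cong π a≡u)))
        (trans (cong π (sym d≡v′)) (trans (sym b~d) (cong π b≡v)))
    ... | inj₂ (inj₁ (b≡u , _)) | inj₁ (a≡u′ , _) =
      ⊥-elim (<-asym u<u′ (subst₂ F._<_ a≡u′ b≡u a<b))
    ... | inj₂ (inj₁ (b≡u , _)) | inj₂ (inj₁ (b≡u′ , _)) = ⊥-elim (FP.<⇒≢ u<u′ (trans (sym b≡u) b≡u′))
    ... | inj₂ (inj₁ (b≡u , c≡v)) | inj₂ (inj₂ (c≡u′ , d≡v′)) =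
      consecutive (trans (sym c≡u′) c≡v) (trans (cong π (sym d≡v′)) (trans (sym b~d) (cong π b≡u)))
        a (trans a~c (cong π c≡v)) (inj₁ (subst (a F.<_) b≡u a<b))
    ... | inj₂ (inj₂ (c≡u , _)) | inj₁ (a≡u′ , _) =
      ⊥-elim (<-asym u<u′ (subst₂ F._<_ a≡u′ c≡u (<-trans a<b b<c)))
    ... | inj₂ (inj₂ (c≡u , _)) | inj₂ (inj₁ (b≡u′ , _)) =
      ⊥-elim (<-asym u<u′ (subst₂ F._<_ b≡u′ c≡u b<c))
    ... | inj₂ (inj₂ (c≡u , _)) | inj₂ (inj₂ (c≡u′ , _)) = ⊥-elim (FP.<⇒≢ u<u′ (trans (sym c≡u) c≡u′))

  u<v : u F.< v
  u<v = adjacent-< A.u⋯v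

  u′<v′ : u′ F.< v′
  u′<v′ = adjacent-< B.u⋯v

  α≁β : ∀ {x y} → π x ≡ α → π y ≡ β → π x ≢ π y
  α≁β x∈α y∈β x~y = α≢β (trans (sym x∈α) (trans x~y y∈β))

  β≁α : ∀ {x y} → π x ≡ β → π y ≡ α → π x ≢ π y
  β≁α x∈β y∈α = α≁β y∈α x∈β ∘ sym

  α≢β-at : ∀ {x y} → π x ≡ α → π y ≡ β → x ≢ y
  α≢β-at x∈α y∈β = label-≢ (α≁β x∈α y∈β)

  pair-size : ∀ {m} → m ≡ 2 → ((m ∸ 1) ≡ᵇ 1) ≡ true
  pair-size refl = refl

  module Separated (v<u′ : v F.< u′) (u′∈α : π u′ ≡ α) (v′∈β : π v′ ≡ β) where

    u<v′ : u F.< v′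
    u<v′ = <-trans u<u′ u′<v′

    v<v′ : v F.< v′
    v<v′ = <-trans v<u′ u′<v′

    α-block : ∀ {x} → π x ≡ α → x ≡ u ⊎ x ≡ u′
    α-block {x} x∈α with FP.<-cmp x u
    ... | tri≈ _ x≡u _ = inj₁ x≡u
    ... | tri< x<u _ _ = ⊥-elim (contradiction₃
          (A×.through-swap (<-trans x<u u<v) v<u′ u′<v′ (trans x∈α (sym u′∈α)) (sym v′∈β) (A×.∈α⇒∉β x∈α))
          (λ (x≡u , _) → FP.<⇒≢ x<u x≡u) (λ (v≡u , _) → A.u≢v (sym v≡u)) (λ (u′≡u , _) → FP.<⇒≢ u<u′ (sym u′≡u)))
    ... | tri> _ _ u<x with FP.<-cmp x u′
    ...   | tri≈ _ x≡u′ _ = inj₂ x≡u′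
    ...   | tri< x<u′ _ _ = ⊥-elim (contradiction₃
            (B×.through-swap u<v v<x (<-trans x<u′ u′<v′) (sym x∈α) (sym v′∈β) α≢β)
            (λ (u≡u′ , _) → FP.<⇒≢ u<u′ u≡u′) (λ (v≡u′ , _) → FP.<⇒≢ v<u′ v≡u′) (λ (x≡u′ , _) → FP.<⇒≢ x<u′ x≡u′))
      where
      v<x : v F.< x
      v<x = above-neighbour (inj₁ A.u⋯v) u<x (A×.∈α⇒≢v x∈α)
    ...   | tri> _ _ u′<x = ⊥-elim (contradiction₃
            (A×.through-swap v<u′ u′<v′ v′<x (sym v′∈β) (trans u′∈α (sym x∈α)) (λ e → α≢β (sym (trans e u′∈α))))
            (λ (v≡u , _) → A.u≢v (sym v≡u)) (λ (u′≡u , _) → FP.<⇒≢ u<u′ (sym u′≡u))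
            (λ (v′≡u , _) → FP.<⇒≢ u<v′ (sym v′≡u)))
      where
      v′<x : v′ F.< x
      v′<x = above-neighbour (inj₁ B.u⋯v) u′<x (α≢β-at x∈α v′∈β)

    β-block : ∀ {x} → π x ≡ β → x ≡ v ⊎ x ≡ v′
    β-block {x} x∈β with FP.<-cmp x v
    ... | tri≈ _ x≡v _ = inj₁ x≡v
    ... | tri< x<v _ _ = ⊥-elim (contradiction₃
          (B×.through-swap x<u u<v v<u′ x∈β (sym u′∈α) (λ e → α≢β (trans (sym e) x∈β)))
          (λ (_ , u≡v′) → FP.<⇒≢ u<v′ u≡v′) (λ (_ , v≡v′) → FP.<⇒≢ v<v′ v≡v′)
          (λ (_ , u′≡v′) → FP.<⇒≢ u′<v′ u′≡v′))
      where
      x<u : x F.< u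
      x<u = below-neighbour (inj₂ A.u⋯v) x<v (≢-sym (α≢β-at refl x∈β))
    ... | tri> _ _ v<x with FP.<-cmp x v′
    ...   | tri≈ _ x≡v′ _ = inj₂ x≡v′
    ...   | tri< x<v′ _ _ = ⊥-elim (contradiction₃
            (A×.through-swap (<-trans u<v v<x) x<u′ u′<v′ (sym u′∈α) (trans x∈β (sym v′∈β))
                             (λ e → α≢β (trans e x∈β)))
            (λ (_ , x≡v) → FP.<⇒≢ v<x (sym x≡v)) (λ (x≡u , _) → FP.<⇒≢ (<-trans u<v v<x) (sym x≡u))
            (λ (u′≡u , _) → FP.<⇒≢ u<u′ (sym u′≡u)))
      where
      x<u′ : x F.< u′
      x<u′ = below-neighbour (inj₂ B.u⋯v) x<v′ (≢-sym (α≢β-at u′∈α x∈β))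
    ...   | tri> _ _ v′<x = ⊥-elim (contradiction₃
            (B×.through-swap u<v v<u′ (<-trans u′<v′ v′<x) (sym u′∈α) (sym x∈β) α≢β)
            (λ (u≡u′ , _) → FP.<⇒≢ u<u′ u≡u′) (λ (v≡u′ , _) → FP.<⇒≢ v<u′ v≡u′)
            (λ (_ , x≡v′) → FP.<⇒≢ v′<x (sym x≡v′)))

    data Spot (x : Fin n) : Set where
      at-u  : x ≡ u → Spot x
      at-v  : x ≡ v → Spot x
      at-u′ : x ≡ u′ → Spot x
      at-v′ : x ≡ v′ → Spot x
      off   : π x ≢ α → π x ≢ β → Spot x

    spot : ∀ x → Spot x
    spot x with π x ℕ.≟ α | π x ℕ.≟ β
    ... | yes x∈α | _       = [ at-u , at-u′ ]′ (α-block x∈α)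
    ... | no _    | yes x∈β = [ at-v , at-v′ ]′ (β-block x∈β)
    ... | no x∉α  | no x∉β  = off x∉α x∉β

    u≢u′ : u ≢ u′
    u≢u′ = FP.<⇒≢ u<u′

    u≢v′ : u ≢ v′
    u≢v′ = FP.<⇒≢ u<v′

    v≢u′ : v ≢ u′
    v≢u′ = FP.<⇒≢ v<u′

    v≢v′ : v ≢ v′
    v≢v′ = FP.<⇒≢ v<v′

    module Off {x} (x∉α : π x ≢ α) (x∉β : π x ≢ β) where
      x≢u : x ≢ u
      x≢u = label-≢ x∉α
      x≢v : x ≢ v
      x≢v = label-≢ x∉β
      x≢u′ : x ≢ u′
      x≢u′ x≡u′ = x∉α (trans (cong π x≡u′) u′∈α)
      x≢v′ : x ≢ v′
      x≢v′ x≡v′ = x∉β (trans (cong π x≡v′) v′∈β)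
      x∉α′ : π x ≢ B.α
      x∉α′ = x∉α ∘ flip trans u′∈α
      x∉β′ : π x ≢ B.β
      x∉β′ = x∉β ∘ flip trans v′∈β

    τ₁-via-τ₁′ : ∀ x → A.τ₁ x ≡ transpose α β (B.τ₁ x)
    τ₁-via-τ₁′ x with spot x
    ... | at-u refl  = ≡-via (transpose α β) A.τ₁-u transpose-a (B.τ₁-elsewhere u≢u′ u≢v′)
    ... | at-v refl  = ≡-via (transpose α β) A.τ₁-v (transpose-b α≢β) (B.τ₁-elsewhere v≢u′ v≢v′)
    ... | at-u′ refl = ≡-via (transpose α β) (trans (A.τ₁-elsewhere (≢-sym u≢u′) (≢-sym v≢u′)) u′∈α)
                                (transpose-b α≢β) (trans B.τ₁-u v′∈β)
    ... | at-v′ refl = ≡-via (transpose α β) (trans (A.τ₁-elsewhere (≢-sym u≢v′) (≢-sym v≢v′)) v′∈β)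
                                transpose-a (trans B.τ₁-v u′∈α)
    ... | off x∉α x∉β = ≡-via (transpose α β) (A.τ₁-elsewhere x≢u x≢v) (transpose-other x∉α x∉β)
                                (B.τ₁-elsewhere x≢u′ x≢v′)
      where open Off x∉α x∉β

    τ₂-via-τ₂′ : ∀ x → A.τ₂ x ≡ transpose 0 1 (B.τ₂ x)
    τ₂-via-τ₂′ x with spot x
    ... | at-u refl  = ≡-via (transpose 0 1) A.τ₂-u (transpose-b λ ()) (B.τ₂-α u≢u′ u≢v′ (sym u′∈α))
    ... | at-v refl  = ≡-via (transpose 0 1) A.τ₂-v (transpose-b λ ()) (B.τ₂-β v≢u′ v≢v′ (sym v′∈β))
    ... | at-u′ refl = ≡-via (transpose 0 1) (A.τ₂-α (≢-sym u≢u′) (≢-sym v≢u′) u′∈α) transpose-a B.τ₂-u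
    ... | at-v′ refl = ≡-via (transpose 0 1) (A.τ₂-β (≢-sym u≢v′) (≢-sym v≢v′) v′∈β) transpose-a B.τ₂-v
    ... | off x∉α x∉β = ≡-via (transpose 0 1) (A.τ₂-apart x≢u x≢v x∉α x∉β) (transpose-other (λ ()) (λ ()))
                                (B.τ₂-apart x≢u′ x≢v′ x∉α′ x∉β′)
      where open Off x∉α x∉β

    σ-equal : ∀ ρ → coeff (σ π j p) ρ ≡ coeff (σ π j′ p′) ρ
    σ-equal ρ = begin
      coeff (σ π j p) ρ
        ≡⟨ cong (λ L → coeff L ρ) (A.σ-τ₁τ₂ (pair-size β-size) (pair-size α-size)) ⟩
      coeff ((1ℚ , A.τ₁) ∷ (1ℚ , A.τ₂) ∷ []) ρ
        ≡⟨ coeff-cong ρ ((refl , τ₁≈) ∷ (refl , τ₂≈) ∷ []) ⟩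
      coeff ((1ℚ , B.τ₁) ∷ (1ℚ , B.τ₂) ∷ []) ρ
        ≡⟨ cong (λ L → coeff L ρ) (sym (B.σ-τ₁τ₂ (pair-size (trans (cong (blockSize π) v′∈β) β-size))
                                                (pair-size (trans (cong (blockSize π) u′∈α) α-size)))) ⟩
      coeff (σ π j′ p′) ρ ∎
      where
      α-size : blockSize π α ≡ 2
      α-size = blockSize-pair refl u′∈α u≢u′ α-block
      β-size : blockSize π β ≡ 2
      β-size = blockSize-pair refl v′∈β v≢v′ β-block
      τ₁≈ : A.τ₁ ≈ₚ B.τ₁
      τ₁≈ = ≈ₚ-by-involution (transpose α β) (transpose-involutive α≢β) τ₁-via-τ₁′
      τ₂≈ : A.τ₂ ≈ₚ B.τ₂
      τ₂≈ = ≈ₚ-by-involution (transpose 0 1) (transpose-involutive λ ()) τ₂-via-τ₂′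

  module Consecutive (u′≡v : u′ ≡ v) (v′∈α : π v′ ≡ α) (e : Fin n) (e∈β : π e ≡ β)
                     (e-outside : e F.< u ⊎ v′ F.< e) where

    v⋯v′ : Adjacent v v′
    v⋯v′ = subst (λ z → Adjacent z v′) u′≡v B.u⋯v

    v<v′ : v F.< v′
    v<v′ = adjacent-< v⋯v′

    u<v′ : u F.< v′
    u<v′ = <-trans u<v v<v′

    α′≡β : B.α ≡ β
    α′≡β = cong π u′≡v

    private
      left-of-u : ∀ {x} → π x ≡ α → x F.< u → e F.< u ⊎ v′ F.< e → ⊥
      left-of-u {x} x∈α x<u (inj₂ v′<e) = contradiction₃
            (A×.through-swap (<-trans x<u u<v) v<v′ v′<e (trans x∈α (sym v′∈α)) (sym e∈β) (A×.∈α⇒∉β x∈α))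
            (λ (x≡u , _) → FP.<⇒≢ x<u x≡u) (λ (v≡u , _) → A.u≢v (sym v≡u)) (λ (v′≡u , _) → FP.<⇒≢ u<v′ (sym v′≡u))
      left-of-u {x} x∈α x<u (inj₁ e<u) with FP.<-cmp e x
      ... | tri< e<x _ _ = contradiction₃
              (A×.through-swap e<x (<-trans x<u u<v) v<v′ e∈β (trans x∈α (sym v′∈α)) (β≁α e∈β x∈α))
              (λ (e≡u , _) → FP.<⇒≢ e<u e≡u) (λ (x≡u , _) → FP.<⇒≢ x<u x≡u) (λ (v≡u , _) → A.u≢v (sym v≡u))
      ... | tri≈ _ e≡x _ = α≢β-at x∈α e∈β (sym e≡x)
      ... | tri> _ _ x<e = contradiction₃
              (B×.through-swap x<e e<u u<v x∈α e∈β (α≁β x∈α e∈β))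
              (λ (_ , e≡v′) → FP.<⇒≢ (<-trans e<u u<v′) e≡v′) (λ (_ , u≡v′) → FP.<⇒≢ u<v′ u≡v′)
              (λ (_ , v≡v′) → FP.<⇒≢ v<v′ v≡v′)

      right-of-v′ : ∀ {x} → π x ≡ α → v′ F.< x → e F.< u ⊎ v′ F.< e → ⊥
      right-of-v′ {x} x∈α v′<x (inj₁ e<u) = contradiction₃
            (B×.through-swap e<u u<v (<-trans v<v′ v′<x) e∈β (sym x∈α) (β≁α e∈β refl))
            (λ (_ , u≡v′) → FP.<⇒≢ u<v′ u≡v′) (λ (_ , v≡v′) → FP.<⇒≢ v<v′ v≡v′)
            (λ (_ , x≡v′) → FP.<⇒≢ v′<x (sym x≡v′))
      right-of-v′ {x} x∈α v′<x (inj₂ v′<e) with FP.<-cmp e x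
      ... | tri< e<x _ _ = contradiction₃
              (A×.through-swap v<v′ v′<e e<x (sym e∈β) (trans v′∈α (sym x∈α)) (β≁α refl v′∈α))
              (λ (v≡u , _) → A.u≢v (sym v≡u)) (λ (v′≡u , _) → FP.<⇒≢ u<v′ (sym v′≡u))
              (λ (e≡u , _) → FP.<⇒≢ (<-trans u<v′ v′<e) (sym e≡u))
      ... | tri≈ _ e≡x _ = α≢β-at x∈α e∈β (sym e≡x)
      ... | tri> _ _ x<e = contradiction₃
              (B×.through-swap u<v (<-trans v<v′ v′<x) x<e (sym x∈α) (sym e∈β) α≢β)
              (λ (_ , v≡v′) → FP.<⇒≢ v<v′ v≡v′) (λ (_ , x≡v′) → FP.<⇒≢ v′<x (sym x≡v′))
              (λ (_ , e≡v′) → FP.<⇒≢ (<-trans v′<x x<e) (sym e≡v′))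

    α-block : ∀ {x} → π x ≡ α → x ≡ u ⊎ x ≡ v′
    α-block {x} x∈α with FP.<-cmp x u
    ... | tri≈ _ x≡u _ = inj₁ x≡u
    ... | tri< x<u _ _ = ⊥-elim (left-of-u x∈α x<u e-outside)
    ... | tri> _ _ u<x with FP.<-cmp x v′
    ...   | tri≈ _ x≡v′ _ = inj₂ x≡v′
    ...   | tri< x<v′ _ _ =
      ⊥-elim (adjacent-nothing-between v⋯v′ (above-neighbour (inj₁ A.u⋯v) u<x (A×.∈α⇒≢v x∈α)) x<v′)
    ...   | tri> _ _ v′<x = ⊥-elim (right-of-v′ x∈α v′<x e-outside)

    u≢u′ : u ≢ u′
    u≢u′ u≡u′ = A.u≢v (trans u≡u′ u′≡v)

    u≢v′ : u ≢ v′
    u≢v′ = FP.<⇒≢ u<v′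

    v′≢u : v′ ≢ u
    v′≢u = ≢-sym u≢v′

    v′≢v : v′ ≢ v
    v′≢v = ≢-sym (FP.<⇒≢ v<v′)

    at-u′ : ∀ {P : Fin n → Set} → P u′ → P v
    at-u′ {P} = subst P u′≡v

    data Spot (x : Fin n) : Set where
      at-u  : x ≡ u → Spot x
      at-v  : x ≡ v → Spot x
      at-v′ : x ≡ v′ → Spot x
      in-β  : x ≢ v → π x ≡ β → Spot x
      off   : π x ≢ α → π x ≢ β → Spot x

    spot : ∀ x → Spot x
    spot x with π x ℕ.≟ α | x F.≟ v | π x ℕ.≟ β
    ... | yes x∈α | _       | _       = [ at-u , at-v′ ]′ (α-block x∈α)
    ... | no _    | yes x≡v | _       = at-v x≡v
    ... | no _    | no x≢v  | yes x∈β = in-β x≢v x∈β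
    ... | no x∉α  | no _    | no x∉β  = off x∉α x∉β

    module InB {x} (x≢v : x ≢ v) (x∈β : π x ≡ β) where
      x≢u : x ≢ u
      x≢u = label-≢ (β≁α x∈β refl)
      x≢u′ : x ≢ u′
      x≢u′ x≡u′ = x≢v (trans x≡u′ u′≡v)
      x≢v′ : x ≢ v′
      x≢v′ = label-≢ (β≁α x∈β v′∈α)
      x∈α′ : π x ≡ B.α
      x∈α′ = trans x∈β (sym α′≡β)
      x∉β′ : π x ≢ B.β
      x∉β′ = β≁α x∈β v′∈α
      A-τ₁ : A.τ₁ x ≡ β
      A-τ₁ = trans (A.τ₁-elsewhere x≢u x≢v) x∈β
      B-τ₁ : B.τ₁ x ≡ β
      B-τ₁ = trans (B.τ₁-elsewhere x≢u′ x≢v′) x∈β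

    module Off {x} (x∉α : π x ≢ α) (x∉β : π x ≢ β) where
      x≢u : x ≢ u
      x≢u = label-≢ x∉α
      x≢v : x ≢ v
      x≢v = label-≢ x∉β
      x≢u′ : x ≢ u′
      x≢u′ x≡u′ = x∉β (trans (cong π x≡u′) α′≡β)
      x≢v′ : x ≢ v′
      x≢v′ x≡v′ = x∉α (trans (cong π x≡v′) v′∈α)
      x∉α′ : π x ≢ B.α
      x∉α′ = x∉β ∘ flip trans α′≡β
      x∉β′ : π x ≢ B.β
      x∉β′ = x∉α ∘ flip trans v′∈α

    A-τ₁-v′ : A.τ₁ v′ ≡ α
    A-τ₁-v′ = trans (A.τ₁-elsewhere v′≢u v′≢v) v′∈α

    A-τ₂-v′ : A.τ₂ v′ ≡ 1
    A-τ₂-v′ = A.τ₂-α v′≢u v′≢v v′∈α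

    B-τ₁-u : B.τ₁ u ≡ α
    B-τ₁-u = B.τ₁-elsewhere u≢u′ u≢v′

    B-τ₁-v : B.τ₁ v ≡ α
    B-τ₁-v = at-u′ {λ z → B.τ₁ z ≡ α} (trans B.τ₁-u v′∈α)

    B-τ₁-v′ : B.τ₁ v′ ≡ β
    B-τ₁-v′ = trans B.τ₁-v α′≡β

    B-τ₂-u : B.τ₂ u ≡ 1
    B-τ₂-u = B.τ₂-β u≢u′ u≢v′ (sym v′∈α)

    B-τ₂-v : B.τ₂ v ≡ 0
    B-τ₂-v = at-u′ {λ z → B.τ₂ z ≡ 0} B.τ₂-u

    B-τ₄-v : B.τ₄ v ≡ 0
    B-τ₄-v = at-u′ {λ z → B.τ₄ z ≡ 0} B.τ₄-u

    τ₁-via-τ₂′ : ∀ x → A.τ₁ x ≡ unpack α β (B.τ₂ x)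
    τ₁-via-τ₂′ x with spot x
    ... | at-u refl    = ≡-via (unpack α β) A.τ₁-u refl B-τ₂-u
    ... | at-v refl    = ≡-via (unpack α β) A.τ₁-v refl B-τ₂-v
    ... | at-v′ refl   = ≡-via (unpack α β) A-τ₁-v′ refl B.τ₂-v
    ... | in-β x≢v x∈β = ≡-via (unpack α β) A-τ₁ refl (B.τ₂-α x≢u′ x≢v′ x∈α′)
      where open InB x≢v x∈β
    ... | off x∉α x∉β  = ≡-via (unpack α β) (A.τ₁-elsewhere x≢u x≢v) refl (B.τ₂-apart x≢u′ x≢v′ x∉α′ x∉β′)
      where open Off x∉α x∉β

    τ₂′-via-τ₁ : ∀ x → B.τ₂ x ≡ pack α β (A.τ₁ x)
    τ₂′-via-τ₁ x with spot x
    ... | at-u refl    = ≡-via (pack α β) B-τ₂-u (pack-b α≢β) A.τ₁-u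
    ... | at-v refl    = ≡-via (pack α β) B-τ₂-v pack-a A.τ₁-v
    ... | at-v′ refl   = ≡-via (pack α β) B.τ₂-v pack-a A-τ₁-v′
    ... | in-β x≢v x∈β = ≡-via (pack α β) (B.τ₂-α x≢u′ x≢v′ x∈α′) (pack-b α≢β) A-τ₁
      where open InB x≢v x∈β
    ... | off x∉α x∉β  = ≡-via (pack α β) (B.τ₂-apart x≢u′ x≢v′ x∉α′ x∉β′) (pack-other x∉α x∉β)
                                 (A.τ₁-elsewhere x≢u x≢v)
      where open Off x∉α x∉β

    τ₂-via-τ₁′ : ∀ x → A.τ₂ x ≡ pack α β (B.τ₁ x)
    τ₂-via-τ₁′ x with spot x
    ... | at-u refl    = ≡-via (pack α β) A.τ₂-u pack-a B-τ₁-u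
    ... | at-v refl    = ≡-via (pack α β) A.τ₂-v pack-a B-τ₁-v
    ... | at-v′ refl   = ≡-via (pack α β) A-τ₂-v′ (pack-b α≢β) B-τ₁-v′
    ... | in-β x≢v x∈β = ≡-via (pack α β) (A.τ₂-β x≢u x≢v x∈β) (pack-b α≢β) B-τ₁
      where open InB x≢v x∈β
    ... | off x∉α x∉β  = ≡-via (pack α β) (A.τ₂-apart x≢u x≢v x∉α x∉β) (pack-other x∉α x∉β)
                                 (B.τ₁-elsewhere x≢u′ x≢v′)
      where open Off x∉α x∉β

    τ₁′-via-τ₂ : ∀ x → B.τ₁ x ≡ unpack α β (A.τ₂ x)
    τ₁′-via-τ₂ x with spot x
    ... | at-u refl    = ≡-via (unpack α β) B-τ₁-u refl A.τ₂-u
    ... | at-v refl    = ≡-via (unpack α β) B-τ₁-v refl A.τ₂-v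
    ... | at-v′ refl   = ≡-via (unpack α β) B-τ₁-v′ refl A-τ₂-v′
    ... | in-β x≢v x∈β = ≡-via (unpack α β) B-τ₁ refl (A.τ₂-β x≢u x≢v x∈β)
      where open InB x≢v x∈β
    ... | off x∉α x∉β  = ≡-via (unpack α β) (B.τ₁-elsewhere x≢u′ x≢v′) refl (A.τ₂-apart x≢u x≢v x∉α x∉β)
      where open Off x∉α x∉β

    τ₃≗τ₄′ : A.τ₃ ≗ B.τ₄
    τ₃≗τ₄′ x with spot x
    ... | at-u refl    = trans A.τ₃-u (sym (B.τ₄-β (sym v′∈α)))
    ... | at-v refl    = trans A.τ₃-v (sym B-τ₄-v)
    ... | at-v′ refl   = trans (A.τ₃-α v′∈α) (sym B.τ₄-v)
    ... | in-β x≢v x∈β = trans (A.τ₃-β x≢u x≢v (β≁α x∈β refl) x∈β) (sym (B.τ₄-α x≢u′ x≢v′ x∉β′ x∈α′))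
      where open InB x≢v x∈β
    ... | off x∉α x∉β  = trans (A.τ₃-apart x≢u x≢v x∉α x∉β) (sym (B.τ₄-apart x≢u′ x≢v′ x∉α′ x∉β′))
      where open Off x∉α x∉β

    σ-equal : ∀ ρ → coeff (σ π j p) ρ ≡ coeff (σ π j′ p′) ρ
    σ-equal ρ = begin
      coeff (σ π j p) ρ
        ≡⟨ cong (λ L → coeff L ρ) (A.σ-τ₁τ₂τ₃ (pair-size α-size)) ⟩
      coeff ((1ℚ , A.τ₁) ∷ (1ℚ , A.τ₂) ∷ (if A.ℓ ≡ᵇ 1 then [] else (- 1ℚ , A.τ₃) ∷ [])) ρ
        ≡⟨ coeff-cong ρ ((refl , τ₁≈τ₂′) ∷ (refl , τ₂≈τ₁′) ∷ if-pointwise same-condition (≗⇒≈ₚ τ₃≗τ₄′)) ⟩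
      coeff ((1ℚ , B.τ₂) ∷ (1ℚ , B.τ₁) ∷ (if B.k ≡ᵇ 1 then [] else (- 1ℚ , B.τ₄) ∷ [])) ρ
        ≡⟨ coeff-swap (1ℚ , B.τ₂) (1ℚ , B.τ₁) (if B.k ≡ᵇ 1 then [] else (- 1ℚ , B.τ₄) ∷ []) ρ ⟩
      coeff ((1ℚ , B.τ₁) ∷ (1ℚ , B.τ₂) ∷ (if B.k ≡ᵇ 1 then [] else (- 1ℚ , B.τ₄) ∷ [])) ρ
        ≡⟨ cong (λ L → coeff L ρ) (sym (B.σ-τ₁τ₂τ₄ (pair-size (trans (cong (blockSize π) v′∈α) α-size)))) ⟩
      coeff (σ π j′ p′) ρ ∎
      where
      α-size : blockSize π α ≡ 2
      α-size = blockSize-pair refl v′∈α u≢v′ α-block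
      same-condition : (A.ℓ ≡ᵇ 1) ≡ (B.k ≡ᵇ 1)
      same-condition = cong (λ c → (blockSize π c ∸ 1) ≡ᵇ 1) (sym α′≡β)
      τ₁≈τ₂′ : A.τ₁ ≈ₚ B.τ₂
      τ₁≈τ₂′ = relabel-≈ₚ (unpack α β) (pack α β) τ₁-via-τ₂′ τ₂′-via-τ₁
      τ₂≈τ₁′ : A.τ₂ ≈ₚ B.τ₁
      τ₂≈τ₁′ = relabel-≈ₚ (pack α β) (unpack α β) τ₂-via-τ₁′ τ₁′-via-τ₂

  σ-equal : ∀ ρ → coeff (σ π j p) ρ ≡ coeff (σ π j′ p′) ρ
  σ-equal with shape
  ... | consecutive u′≡v v′∈α e e∈β e-outside = Consecutive.σ-equal u′≡v v′∈α e e∈β e-outside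
  ... | separated v<u′ u′∈α v′∈β              = Separated.σ-equal v<u′ u′∈α v′∈β

σ-independent : ∀ {n} (π : SetPartition n) j (p : suc j < n) j′ (p′ : suc j′ < n) →
  CrossesAt π j p → CrossesAt π j′ p′ → ∀ ρ → coeff (σ π j p) ρ ≡ coeff (σ π j′ p′) ρ
σ-independent π j p j′ p′ (¬nc , nc) (_ , nc′) with <-cmp j j′
... | tri< j<j′ _ _ = TwoSwaps.σ-equal π p p′ j<j′ ¬nc nc nc′
... | tri≈ _ refl _ = λ ρ → cong (λ q → coeff (σ π j q) ρ) (<-irrelevant p p′)
... | tri> _ _ j′<j = λ ρ → sym (TwoSwaps.σ-equal π p′ p j′<j ¬nc nc′ nc ρ)

lemma3p3 : (n : ℕ) (π : SetPartition n) → AlmostNoncrossing π →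
    ((j : ℕ) (p : suc j < n) → CrossesAt π j p →
      (ρ : SetPartition n) → coeff (σ π j p) ρ ≢ 0ℚ →
        NonCrossing ρ × numBlocks ρ ≡ numBlocks π × numSingletons ρ ≡ numSingletons π)
    × ((j : ℕ) (p : suc j < n) (j′ : ℕ) (p′ : suc j′ < n) →
        CrossesAt π j p → CrossesAt π j′ p′ →
        (ρ : SetPartition n) → coeff (σ π j p) ρ ≡ coeff (σ π j′ p′) ρ)
lemma3p3 n π _ = σ-support-admissible π , σ-independent π
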